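{- For every gehm $\mathbb{H}$, the Tutte polynomial $T(\mathbb{H};x,y)$ is a polynomial in $\sqrt{x-1}$ and $\sqrt{y-1}$; i.e., for every $A\subseteq E(\mathbb{H})$ the exponents $\rho(\mathbb{H})-\rho(A)$ and $d(A)-|A|-\rho(A)$ are non-negative half-integers.
   Context: A gehm is a finite cubic graph whose edges are properly coloured with colours $b,g,r$, together with possibly some isolates ($g$-coloured edges meeting no vertex). Hyperedges are $b$--$r$-cycles, hyperfaces are $b$--$g$-cycles or isolates, hypervertices are $g$--$r$-cycles or isolates. $E(\mathbb{H})$, $e(\mathbb{H})$, $v(\mathbb{H})$, $f(\mathbb{H})$ denote the set of hyperedges and the numbers of hyperedges, hypervertices and hyperfaces; $k(\mathbb{H})$ is the number of connected components (isolates count); $d(e)$ is half the number of gehm-edges in hyperedge $e$, $d(A)=\sum_{e\in A}d(e)$, $d(\mathbb{H})=d(E(\mathbb{H}))$. The Euler genus is $\gamma(\mathbb{H})=2k(\mathbb{H})-v(\mathbb{H})-e(\mathbb{H})+d(\mathbb{H})-f(\mathbb{H})$. Suppressing a degree-two vertex: if its only edge is a loop, replace it and the loop by an isolate; otherwise contract one incident edge. Deleting a hyperedge $e$: delete its $b$-edges, contract its $r$-edges, suppress degree-two vertices. For $A\subseteq E(\mathbb{H})$, $\mathbb{H}_{|A}$ is obtained by deleting all hyperedges not in $A$; $v(A),k(A),f(A),\gamma(A)$ are the corresponding quantities of $\mathbb{H}_{|A}$ (note $v(A)=v(\mathbb{H})$). Set $\rho(\mathbb{H})=v(\mathbb{H})-k(\mathbb{H})+\tfrac12\gamma(\mathbb{H})$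 and $\rho(A)=v(A)-k(A)+\tfrac12\gamma(A)$. Tutte polynomial: $T(\mathbb{H};x,y)=\sum_{A\subseteq E(\mathbb{H})}(x-1)^{\rho(\mathbb{H})-\rho(A)}(y-1)^{d(A)-|A|-\rho(A)}$. -}

module Defs where

open import Data.Nat as ℕ using (ℕ; zero; suc; _<ᵇ_; _≤ᵇ_)
open import Data.Nat.DivMod using (_/_)
open import Data.Bool using (Bool; true; false; _∧_; _∨_; not; if_then_else_)
open import Data.Fin using (Fin; toℕ)
open import Data.Fin.Properties using () renaming (_≟_ to _≟ᶠ_)
open import Data.List using (List; []; _∷_; map; filter; length)
open import Data.Bool.ListAction using (any; all)
open import Data.Nat.ListAction using (sum)
open import Data.List using () renaming (allFin to allFinL)
open import Data.Integer as ℤ using (ℤ; +_)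
open import Data.Rational as ℚ using (ℚ)
open import Relation.Nullary.Decidable using (⌊_⌋)
open import Relation.Binary.PropositionalEquality using (_≡_; _≢_)

-- A finite cubic graph whose edges are properly 3-coloured by b, g, r
-- is encoded (as usual for gems) by its vertex set Fin n together with,
-- for each colour c, the fixed-point-free involution sending a vertex to
-- the other end of its unique c-coloured edge (parallel edges allowed).
-- `iso` is the number of isolates.

record Gehm : Set where
  field
    n     : ℕ
    b g r : Fin n → Fin n
    b-inv : ∀ x → b (b x) ≡ x
    g-inv : ∀ x → g (g x) ≡ x
    r-inv : ∀ x → r (r x) ≡ x
    b-fpf : ∀ x → b x ≢ x
    g-fpf : ∀ x → g x ≢ x
    r-fpf : ∀ x → r x ≢ x
    iso   : ℕ

Pred : ℕ → Set
Pred n = Fin n → Bool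

_==_ : ∀ {n} → Fin n → Fin n → Bool
x == y = ⌊ x ≟ᶠ y ⌋

count : ∀ {n} → Pred n → ℕ
count {n} P = length (filter (λ x → Data.Bool.T? (P x)) (allFinL n))
  where import Data.Bool

step : ∀ {n} → List (Fin n → Fin n) → Pred n → Pred n
step {n} fs P y = P y ∨ any (λ x → P x ∧ any (λ f → f x == y) fs) (allFinL n)

iter : ∀ {A : Set} → ℕ → (A → A) → A → A
iter zero    h a = a
iter (suc k) h a = h (iter k h a)

-- vertices reachable from x using the edges given by the maps fs
-- (n iterations suffice on n vertices)
reach : ∀ {n} → List (Fin n → Fin n) → Fin n → Pred n
reach {n} fs x = iter n (step fs) (x ==_)

isRep : ∀ {n} → List (Fin n → Fin n) → Fin n → Bool
isRep {n} fs x = all (λ y → not (reach fs x y) ∨ (toℕ x ≤ᵇ toℕ y)) (allFinL n)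

-- number of connected components (w.r.t. fs) contained in the
-- vertex set S (S is assumed closed under fs)
ncomp : ∀ {n} → List (Fin n → Fin n) → Pred n → ℕ
ncomp fs S = count (λ x → S x ∧ isRep fs x)

nedges : ∀ {n} → (Fin n → Fin n) → Pred n → ℕ
nedges c P = count (λ x → P x ∧ P (c x) ∧ (toℕ x <ᵇ toℕ (c x)))

module _ (H : Gehm) where
  open Gehm H

  -- the b-r-cycles (hyperedges) are the components of the b,r-graph;
  -- a hyperedge is represented by its least vertex
  isHyperedge : Fin n → Bool
  isHyperedge = isRep (b ∷ r ∷ [])

  dEdge : Fin n → ℕ
  dEdge e = (nedges b (reach (b ∷ r ∷ []) e) ℕ.+ nedges r (reach (b ∷ r ∷ []) e)) / 2

  -- a subset A ⊆ E(H): a set of hyperedge representatives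
  IsEdgeSet : Pred n → Set
  IsEdgeSet A = ∀ x → A x ≡ true → isHyperedge x ≡ true

  supp : Pred n → Pred n
  supp A x = any (λ e → A e ∧ reach (b ∷ r ∷ []) e x) (allFinL n)

  card : Pred n → ℕ
  card A = count A

  dSet : Pred n → ℕ
  dSet A = sum (map (λ e → if A e then dEdge e else 0) (allFinL n))

  -- H|A: deleting the hyperedges outside A (delete their b-edges,
  -- contract their r-edges, suppress degree-two vertices) leaves the
  -- vertices S = supp A with b, r unchanged, and new g-colouring gA:
  -- gA x is the first vertex of S met on the alternating g,r-walk from x
  -- starting with g.  (Fuel suc n is more than enough.)
  walk : Pred n → ℕ → Fin n → Fin n
  walk S zero    y = y
  walk S (suc k) y = if S y then y else walk S k (g (r y))

  gA : Pred n → Fin n → Fin n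
  gA A x = walk (supp A) (suc n) (g x)

  -- each g-r-cycle lying entirely on deleted hyperedges becomes an isolate
  isoA : Pred n → ℕ
  isoA A = iso ℕ.+ count (λ x → isRep (g ∷ r ∷ []) x
                           ∧ all (λ y → not (reach (g ∷ r ∷ []) x y) ∨ not (supp A y)) (allFinL n))

  -- Numerical invariants of a gehm given as (vertex set S, colourings
  -- b, g', r, number of isolates i)

  module Inv (S : Pred n) (g' : Fin n → Fin n) (i : ℕ) where
    kk vv ee ff dd : ℕ
    kk = ncomp (b ∷ g' ∷ r ∷ []) S ℕ.+ i
    vv = ncomp (g' ∷ r ∷ []) S ℕ.+ i         -- hypervertices
    ee = ncomp (b ∷ r ∷ []) S                -- hyperedges
    ff = ncomp (b ∷ g' ∷ []) S ℕ.+ i         -- hyperfaces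
    dd = (nedges b S ℕ.+ nedges r S) / 2     -- d = sum of d(e)

    γ : ℤ
    γ = + (2 ℕ.* kk) ℤ.- + vv ℤ.- + ee ℤ.+ + dd ℤ.- + ff

    ρ : ℚ
    ρ = (+ vv ℤ.- + kk) ℚ./ 1 ℚ.+ γ ℚ./ 2

  ρH : ℚ
  ρH = Inv.ρ (λ _ → true) g iso

  ρA : Pred n → ℚ
  ρA A = Inv.ρ (supp A) (gA A) (isoA A)

  xExp : Pred n → ℚ
  xExp A = ρH ℚ.- ρA A

  yExp : Pred n → ℚ
  yExp A = (+ dSet A ℤ.- + card A) ℚ./ 1 ℚ.- ρA A

NonNegHalfInt : ℚ → Set
NonNegHalfInt q = Data.Product.∃ λ (m : ℕ) → q ≡ (+ m) ℚ./ 2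
  where import Data.Product

{-# OPTIONS --safe #-}
-- Since 2ρ = v − e + d − f, both exponents are halves of integers, and their non-negativity is an
-- inequality between numbers of connected components. Counted by least vertices, these numbers are
-- submodular: adding the edges of an involution to a graph merges at least as many components as
-- adding them to a coarser graph. Let S be the set of vertices on hyperedges of A, and take the
-- graph with the b-edges inside S, the r-edges outside S and all g-edges: contracting its r-edges
-- gives the b,gA-graph of H|A plus the g,r-cycles avoiding S. Adding the r-edges outside S both to
-- the b-edges outside S and to the b,g-graph gives the x-inequality; adding the b-edges inside S
-- both to the r-edges inside S and to the g,r-graph gives v + e ≤ d + f for H|A, whence the
-- y-inequality.

module Submission where

open import Defs
open import Data.Bool using (Bool; true; false; _∧_; _∨_; not; if_then_else_; T; T?)
open import Data.Bool.Properties using (T-≡; not-involutive; ∧-comm; ∧-zeroʳ; ∧-identityʳ; ∧-distribʳ-∨)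
  renaming (_≟_ to _≟ᵇ_)
open import Data.Bool.ListAction using (any; all)
open import Data.Fin using (Fin; toℕ) renaming (zero to fzero; suc to fsuc)
open import Data.Fin.Properties using (toℕ-injective; toℕ<n; any?; pigeonhole)
  renaming (suc-injective to fsuc-injective; _≟_ to _≟ᶠ_)
open import Data.List using (List; []; _∷_; _++_; map; filter; length; tabulate; allFin)
open import Data.List.Membership.Propositional using (_∈_; find; lose)
open import Data.List.Membership.Propositional.Properties
  using (∈-allFin; ∈-map⁺; ∈-map⁻; ∈-++⁺ˡ; ∈-++⁺ʳ; ∈-++⁻)
open import Data.List.Relation.Unary.All as All using (All)
open import Data.List.Relation.Unary.All.Properties using (all⁺; all⁻; ¬All⇒Any¬)
open import Data.List.Relation.Unary.Any using (here; there)
open import Data.List.Relation.Unary.Any.Properties using (any⁺; any⁻)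
open import Data.Nat as ℕ using (ℕ; zero; suc; _+_; _∸_; _≤_; _<_; z≤n; s≤s; _≤ᵇ_; _<ᵇ_)
open import Data.Nat.ListAction using (sum)
open import Data.Nat.Solver using (module +-*-Solver)
open import Data.Nat.Properties
open import Data.Nat.DivMod using (m*n/n≡m)
open import Data.Product using (_×_; _,_; proj₁; proj₂; ∃-syntax)
open import Data.Sum using (_⊎_; inj₁; inj₂)
open import Relation.Binary.Definitions using (tri<; tri≈; tri>)
open import Function using (_∘_; _⇔_; mk⇔; Equivalence)
open import Relation.Binary.PropositionalEquality
  using (_≡_; _≢_; refl; sym; trans; cong; cong₂; subst; subst₂; module ≡-Reasoning)
open import Relation.Nullary using (¬_; ¬?; yes; no; contradiction)
open import Relation.Nullary.Decidable using (dec-true; dec-false; decidable-stable; isYes≗does; ⌊⌋-map′; toWitness; _×-dec_)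

open Equivalence using (to; from)

bool-ext : ∀ {a b : Bool} → (a ≡ true → b ≡ true) → (b ≡ true → a ≡ true) → a ≡ b
bool-ext {true}  a⇒b _   = sym (a⇒b refl)
bool-ext {false} {true}  _ b⇒a = b⇒a refl
bool-ext {false} {false} _ _   = refl

true≢false : true ≢ false
true≢false ()

∧-intro : ∀ {a b} → a ≡ true → b ≡ true → (a ∧ b) ≡ true
∧-intro refl refl = refl

∧-elimˡ : ∀ a {b} → (a ∧ b) ≡ true → a ≡ true
∧-elimˡ true _ = refl

∧-elimʳ : ∀ a {b} → (a ∧ b) ≡ true → b ≡ true
∧-elimʳ true e = e

∨-introˡ : ∀ {a} b → a ≡ true → (a ∨ b) ≡ true
∨-introˡ _ refl = refl

∨-introʳ : ∀ a {b} → b ≡ true → (a ∨ b) ≡ true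
∨-introʳ true  _ = refl
∨-introʳ false e = e

∨-elim : ∀ a {b} → (a ∨ b) ≡ true → a ≡ true ⊎ b ≡ true
∨-elim true  _ = inj₁ refl
∨-elim false e = inj₂ e

strict-⇒ : ∀ {a b : Bool} → (a ≡ true → b ≡ true) → b ≢ a → b ≡ true × a ≡ false
strict-⇒ {true}          a⇒b b≢a = contradiction (a⇒b refl) b≢a
strict-⇒ {false} {true}  _   _   = refl , refl
strict-⇒ {false} {false} _   b≢a = contradiction refl b≢a

not-true : ∀ {a} → not a ≡ true → a ≡ false
not-true {false} _ = refl

not-false : ∀ {a} → a ≡ false → not a ≡ true
not-false refl = refl

module _ {A : Set} (p : A → Bool) where

  any-true⁺ : ∀ {x xs} → x ∈ xs → p x ≡ true → any p xs ≡ true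
  any-true⁺ x∈xs px = to T-≡ (any⁺ p (lose x∈xs (from T-≡ px)))

  any-true⁻ : ∀ xs → any p xs ≡ true → ∃[ x ] x ∈ xs × p x ≡ true
  any-true⁻ xs e with find (any⁻ p xs (from T-≡ e))
  ... | x , x∈xs , px = x , x∈xs , to T-≡ px

  all-true⁺ : ∀ xs → (∀ {x} → x ∈ xs → p x ≡ true) → all p xs ≡ true
  all-true⁺ xs h = to T-≡ (all⁻ p (All.tabulate (from T-≡ ∘ h)))

  all-true⁻ : ∀ {x xs} → all p xs ≡ true → x ∈ xs → p x ≡ true
  all-true⁻ e x∈xs = to T-≡ (All.lookup (all⁺ p _ (from T-≡ e)) x∈xs)

  all-false⁻ : ∀ xs → all p xs ≡ false → ∃[ x ] x ∈ xs × p x ≡ false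
  all-false⁻ xs e with find (¬All⇒Any¬ (T? ∘ p) xs (λ ps → subst T e (all⁻ p ps)))
  ... | x , x∈xs , ¬px = x , x∈xs , ¬T⇒false ¬px
    where
    ¬T⇒false : ∀ {b} → ¬ T b → b ≡ false
    ¬T⇒false {false} _  = refl
    ¬T⇒false {true}  ¬t = contradiction _ ¬t

any-cong : ∀ {A : Set} {p q : A → Bool} → (∀ z → p z ≡ q z) → ∀ zs → any p zs ≡ any q zs
any-cong p≡q []       = refl
any-cong p≡q (z ∷ zs) = cong₂ _∨_ (p≡q z) (any-cong p≡q zs)

==-refl : ∀ {n} (x : Fin n) → (x == x) ≡ true
==-refl x = trans (isYes≗does (x ≟ᶠ x)) (dec-true (x ≟ᶠ x) refl)

==⇒≡ : ∀ {n} {x y : Fin n} → (x == y) ≡ true → x ≡ y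
==⇒≡ e = toWitness (from T-≡ e)

≢⇒==false : ∀ {n} {x y : Fin n} → x ≢ y → (x == y) ≡ false
≢⇒==false {x = x} {y} x≢y = trans (isYes≗does (x ≟ᶠ y)) (dec-false (x ≟ᶠ y) x≢y)

==-suc : ∀ {n} (x y : Fin n) → (fsuc x == fsuc y) ≡ (x == y)
==-suc x y = ⌊⌋-map′ (cong fsuc) fsuc-injective (x ≟ᶠ y)

∣_∣ : ∀ {n} → Pred n → ℕ
∣_∣ {zero}  P = 0
∣_∣ {suc n} P = (if P fzero then 1 else 0) + ∣ P ∘ fsuc ∣

count≡∣∣ : ∀ {n} (P : Pred n) → count P ≡ ∣ P ∣
count≡∣∣ P = go P (λ i → i)
  where
  go : ∀ {m n} (P : Pred n) (f : Fin m → Fin n) →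
       length (filter (T? ∘ P) (tabulate f)) ≡ ∣ P ∘ f ∣
  go {zero}  P f = refl
  go {suc m} P f with P (f fzero)
  ... | true  = cong suc (go P (f ∘ fsuc))
  ... | false = go P (f ∘ fsuc)

∣∣-cong : ∀ {n} {P Q : Pred n} → (∀ x → P x ≡ Q x) → ∣ P ∣ ≡ ∣ Q ∣
∣∣-cong {zero}  P≡Q = refl
∣∣-cong {suc n} P≡Q = cong₂ _+_ (cong (λ b → if b then 1 else 0) (P≡Q fzero)) (∣∣-cong (P≡Q ∘ fsuc))

∣false∣≡0 : ∀ {n} → ∣ (λ (_ : Fin n) → false) ∣ ≡ 0
∣false∣≡0 {zero}  = refl
∣false∣≡0 {suc n} = ∣false∣≡0 {n}

∣∣≤n : ∀ {n} (P : Pred n) → ∣ P ∣ ≤ n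
∣∣≤n {zero}  P = z≤n
∣∣≤n {suc n} P with P fzero
... | true  = s≤s (∣∣≤n (P ∘ fsuc))
... | false = m≤n⇒m≤1+n (∣∣≤n (P ∘ fsuc))

∣∣-mono : ∀ {n} {P Q : Pred n} → (∀ x → P x ≡ true → Q x ≡ true) → ∣ P ∣ ≤ ∣ Q ∣
∣∣-mono {zero}  P⊆Q = z≤n
∣∣-mono {suc n} {P} {Q} P⊆Q with P fzero in p0 | Q fzero in q0
... | true  | true  = s≤s (∣∣-mono (P⊆Q ∘ fsuc))
... | true  | false = contradiction (trans (sym (P⊆Q fzero p0)) q0) true≢false
... | false | _     = ≤-trans (∣∣-mono (P⊆Q ∘ fsuc)) (m≤n+m _ _)

∣∣-partition : ∀ {n} (P S : Pred n) → ∣ P ∣ ≡ ∣ (λ x → P x ∧ S x) ∣ + ∣ (λ x → P x ∧ not (S x)) ∣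
∣∣-partition {zero}  P S = refl
∣∣-partition {suc n} P S with P fzero | S fzero | ∣∣-partition (P ∘ fsuc) (S ∘ fsuc)
... | true  | true  | ih = cong suc ih
... | true  | false | ih = trans (cong suc ih) (sym (+-suc _ _))
... | false | _     | ih = ih

∣∣-∨ : ∀ {n} (P Q : Pred n) → ∣ (λ x → P x ∨ Q x) ∣ ≤ ∣ P ∣ + ∣ Q ∣
∣∣-∨ {zero}  P Q = z≤n
∣∣-∨ {suc n} P Q with P fzero | Q fzero | ∣∣-∨ (P ∘ fsuc) (Q ∘ fsuc)
... | true  | true  | ih = s≤s (≤-trans ih (+-monoʳ-≤ ∣ P ∘ fsuc ∣ (n≤1+n _)))
... | true  | false | ih = s≤s ih
... | false | true  | ih = ≤-trans (s≤s ih) (≤-reflexive (sym (+-suc _ _)))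
... | false | false | ih = ih

drop-suc : ∀ {n} (P : Pred (suc n)) y x →
           (P (fsuc x) ∧ not (x == y)) ≡ (P (fsuc x) ∧ not (fsuc x == fsuc y))
drop-suc P y x = cong (λ b → P (fsuc x) ∧ not b) (sym (==-suc x y))

∣∣-remove : ∀ {n} (P : Pred n) {y} → P y ≡ true → ∣ P ∣ ≡ suc ∣ (λ x → P x ∧ not (x == y)) ∣
∣∣-remove {suc n} P {fzero} py rewrite py =
  cong suc (∣∣-cong (λ x → sym (∧-identityʳ (P (fsuc x)))))
∣∣-remove {suc n} P {fsuc y} py with P fzero | ∣∣-remove (P ∘ fsuc) py
... | true  | ih = cong suc (trans ih (cong suc (∣∣-cong (drop-suc P y))))
... | false | ih = trans ih (cong suc (∣∣-cong (drop-suc P y)))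


∣∣-mono-< : ∀ {n} {P Q : Pred n} {y} → (∀ x → P x ≡ true → Q x ≡ true) →
            Q y ≡ true → P y ≡ false → ∣ P ∣ < ∣ Q ∣
∣∣-mono-< {P = P} {Q} {y} P⊆Q qy py = begin-strict
  ∣ P ∣                              <⟨ s≤s (∣∣-mono P⊆Q-y) ⟩
  suc ∣ (λ x → Q x ∧ not (x == y)) ∣ ≡⟨ ∣∣-remove Q qy ⟨
  ∣ Q ∣                              ∎
  where
  open ≤-Reasoning
  P⊆Q-y : ∀ x → P x ≡ true → (Q x ∧ not (x == y)) ≡ true
  P⊆Q-y x px with x ≟ᶠ y
  ... | yes refl = contradiction (trans (sym px) py) true≢false
  ... | no  _    = ∧-intro (P⊆Q x px) refl

∣∣-injection : ∀ {n m} {P : Pred n} {Q : Pred m} (R : Fin n → Fin m → Set) →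
               (∀ x → P x ≡ true → ∃[ y ] Q y ≡ true × R x y) →
               (∀ {x x′ y} → R x y → R x′ y → x ≡ x′) → ∣ P ∣ ≤ ∣ Q ∣
∣∣-injection {zero}  R image injective = z≤n
∣∣-injection {suc n} {P = P} {Q} R image injective with P fzero in p0
... | false = ∣∣-injection (R ∘ fsuc) (image ∘ fsuc) (λ r r′ → fsuc-injective (injective r r′))
... | true with image fzero p0
... | y₀ , qy₀ , ry₀ = begin
  suc ∣ P ∘ fsuc ∣                    ≤⟨ s≤s (∣∣-injection (R ∘ fsuc) image′ (λ r r′ → fsuc-injective (injective r r′))) ⟩
  suc ∣ (λ y → Q y ∧ not (y == y₀)) ∣ ≡⟨ ∣∣-remove Q qy₀ ⟨
  ∣ Q ∣                               ∎
  where
  open ≤-Reasoning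
  image′ : ∀ x → P (fsuc x) ≡ true → ∃[ y ] (Q y ∧ not (y == y₀)) ≡ true × R (fsuc x) y
  image′ x px with image (fsuc x) px
  ... | y , qy , rxy with y ≟ᶠ y₀
  ... | yes refl = contradiction (injective rxy ry₀) λ ()
  ... | no  y≢y₀ = y , ∧-intro qy (not-false (≢⇒==false y≢y₀)) , rxy

Maps : ℕ → Set
Maps n = List (Fin n → Fin n)

data Path {n} (fs : Maps n) (x : Fin n) : Fin n → Set where
  []  : Path fs x x
  _▷_ : ∀ {y f} → Path fs x y → f ∈ fs → Path fs x (f y)

edge : ∀ {n} {fs : Maps n} {f} {x} → f ∈ fs → Path fs x (f x)
edge f∈fs = [] ▷ f∈fs

_▷▷_ : ∀ {n} {fs : Maps n} {x y z} → Path fs x y → Path fs y z → Path fs x z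
p ▷▷ []         = p
p ▷▷ (q ▷ f∈fs) = (p ▷▷ q) ▷ f∈fs

Path-map : ∀ {n} {fs gs : Maps n} → (∀ {f} → f ∈ fs → ∀ z → Path gs z (f z)) →
           ∀ {x y} → Path fs x y → Path gs x y
Path-map fs⇒gs []         = []
Path-map fs⇒gs (p ▷ f∈fs) = Path-map fs⇒gs p ▷▷ fs⇒gs f∈fs _

Path-invariant : ∀ {n} {fs : Maps n} (Q : Fin n → Set) → (∀ {f} → f ∈ fs → ∀ {z} → Q z → Q (f z)) →
                 ∀ {x y} → Q x → Path fs x y → Q y
Path-invariant Q Q-closed qx []         = qx
Path-invariant Q Q-closed qx (p ▷ f∈fs) = Q-closed f∈fs (Path-invariant Q Q-closed qx p)

Involutive : ∀ {n} → Maps n → Set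
Involutive {n} fs = ∀ {f} → f ∈ fs → ∀ (x : Fin n) → f (f x) ≡ x

Path-sym : ∀ {n} {fs : Maps n} → Involutive fs → ∀ {x y} → Path fs x y → Path fs y x
Path-sym inv []                 = []
Path-sym inv (_▷_ {y} p f∈fs) = subst (Path _ _) (inv f∈fs y) (edge f∈fs) ▷▷ Path-sym inv p

step-cong : ∀ {n} (fs : Maps n) {P Q : Pred n} → (∀ y → P y ≡ Q y) → ∀ y → step fs P y ≡ step fs Q y
step-cong {n} fs P≡Q y =
  cong₂ _∨_ (P≡Q y) (any-cong (λ z → cong (_∧ any (λ f → f z == y) fs) (P≡Q z)) (allFin n))

step-⊇ : ∀ {n} (fs : Maps n) (P : Pred n) y → P y ≡ true → step fs P y ≡ true
step-⊇ fs P y = ∨-introˡ _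

step⇒Path : ∀ {n} (fs : Maps n) {x} {P : Pred n} → (∀ y → P y ≡ true → Path fs x y) →
            ∀ y → step fs P y ≡ true → Path fs x y
step⇒Path {n} fs {P = P} P⇒Path y e with ∨-elim (P y) e
... | inj₁ py = P⇒Path y py
... | inj₂ e′ with any-true⁻ (λ z → P z ∧ any (λ f → f z == y) fs) (allFin n) e′
... | z , _ , pz with any-true⁻ (λ f → f z == y) fs (∧-elimʳ (P z) pz)
... | f , f∈fs , fz≡y = subst (Path fs _) (==⇒≡ fz≡y) (P⇒Path z (∧-elimˡ (P z) pz) ▷ f∈fs)

reach⇒Path : ∀ {n} (fs : Maps n) {x y} → reach fs x y ≡ true → Path fs x y
reach⇒Path {n} fs {x} {y} = go n y
  where
  go : ∀ k y → iter k (step fs) (x ==_) y ≡ true → Path fs x y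
  go zero    y e = subst (Path fs x) (==⇒≡ e) []
  go (suc k) y e = step⇒Path fs (go k) y e

-- Every strict stage of the iteration adds a vertex, so the iteration is stable after n stages.
module Saturation {n} (fs : Maps n) (x : Fin n) where

  stage : ℕ → Pred n
  stage k = iter k (step fs) (x ==_)

  Stable : ℕ → Set
  Stable k = ∀ y → stage (suc k) y ≡ stage k y

  grows-or-stable : ∀ k → k < ∣ stage k ∣ ⊎ Stable k
  grows-or-stable zero = inj₁ (subst (0 <_) (sym (∣∣-remove (x ==_) (==-refl x))) (s≤s z≤n))
  grows-or-stable (suc k) with grows-or-stable k
  ... | inj₂ stable = inj₂ (step-cong fs stable)
  ... | inj₁ k<∣k∣ with any? (λ y → ¬? (stage (suc k) y ≟ᵇ stage k y))
  ... | no  none = inj₂ (step-cong fs (λ y → decidable-stable (stage (suc k) y ≟ᵇ stage k y) (λ ne → none (y , ne))))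
  ... | yes (y , changed) with strict-⇒ (step-⊇ fs (stage k) y) changed
  ... | new , old = inj₁ (≤-<-trans k<∣k∣ (∣∣-mono-< (step-⊇ fs (stage k)) new old))

  stable : Stable n
  stable with grows-or-stable n
  ... | inj₁ n<∣n∣ = contradiction (∣∣≤n (stage n)) (<⇒≱ n<∣n∣)
  ... | inj₂ s     = s

  closed : ∀ {z f} → stage n z ≡ true → f ∈ fs → stage n (f z) ≡ true
  closed {z} {f} e f∈fs = trans (sym (stable (f z)))
    (∨-introʳ _ (any-true⁺ _ (∈-allFin z) (∧-intro e (any-true⁺ (λ g → g z == f z) f∈fs (==-refl (f z))))))

  Path⇒stage : ∀ {y} → Path fs x y → stage n y ≡ true
  Path⇒stage [] = grow n (==-refl x)
    where
    grow : ∀ k → stage 0 x ≡ true → stage k x ≡ true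
    grow zero    e = e
    grow (suc k) e = step-⊇ fs (stage k) x (grow k e)
  Path⇒stage (p ▷ f∈fs) = closed (Path⇒stage p) f∈fs

Path⇒reach : ∀ {n} (fs : Maps n) {x y} → Path fs x y → reach fs x y ≡ true
Path⇒reach fs {x} = Saturation.Path⇒stage fs x

reach-closed : ∀ {n} {fs : Maps n} → Involutive fs → ∀ {f} → f ∈ fs → ∀ e x → reach fs e (f x) ≡ reach fs e x
reach-closed {fs = fs} inv {f} f∈fs e x = bool-ext
  (λ e→fx → subst (λ z → reach fs e z ≡ true) (inv f∈fs x) (Path⇒reach fs (reach⇒Path fs e→fx ▷ f∈fs)))
  (λ e→x → Path⇒reach fs (reach⇒Path fs e→x ▷ f∈fs))

IsLeast : ∀ {n} → Maps n → Fin n → Set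
IsLeast fs x = ∀ {y} → Path fs x y → toℕ x ≤ toℕ y

isRep⇒IsLeast : ∀ {n} (fs : Maps n) {x} → isRep fs x ≡ true → IsLeast fs x
isRep⇒IsLeast fs {x} e {y} p with all-true⁻ _ e (∈-allFin y)
... | least rewrite Path⇒reach fs p = ≤ᵇ⇒≤ (toℕ x) (toℕ y) (from T-≡ least)

IsLeast⇒isRep : ∀ {n} (fs : Maps n) {x} → IsLeast fs x → isRep fs x ≡ true
IsLeast⇒isRep {n} fs {x} least = all-true⁺ _ (allFin n) λ {y} _ → lemma y
  where
  lemma : ∀ y → (not (reach fs x y) ∨ (toℕ x ≤ᵇ toℕ y)) ≡ true
  lemma y with reach fs x y in e
  ... | false = refl
  ... | true  = to T-≡ (≤⇒≤ᵇ (least (reach⇒Path fs e)))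

IsLeast-unique : ∀ {n} {fs : Maps n} → Involutive fs → ∀ {x y} →
                 IsLeast fs x → IsLeast fs y → Path fs x y → x ≡ y
IsLeast-unique inv x-least y-least p = toℕ-injective (≤-antisym (x-least p) (y-least (Path-sym inv p)))

least-such-that : ∀ {n} (P : Pred n) {y} → P y ≡ true →
                  ∃[ m ] P m ≡ true × (∀ z → P z ≡ true → toℕ m ≤ toℕ z)
least-such-that {n} P {y} py = descend (suc (toℕ y)) y py ≤-refl
  where
  descend : ∀ fuel y → P y ≡ true → toℕ y < fuel →
            ∃[ m ] P m ≡ true × (∀ z → P z ≡ true → toℕ m ≤ toℕ z)
  descend (suc fuel) y py (s≤s y<fuel) with any? (λ z → (P z ≟ᵇ true) ×-dec (toℕ z <? toℕ y))
  ... | yes (z , pz , z<y) = descend fuel z pz (≤-trans z<y y<fuel)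
  ... | no  none           = y , py , λ z pz → ≮⇒≥ (λ z<y → none (z , pz , z<y))

least-of-class : ∀ {n} (fs : Maps n) u → ∃[ m ] Path fs u m × IsLeast fs m
least-of-class fs u with least-such-that (reach fs u) (Path⇒reach fs [])
... | m , u→m , least = m , reach⇒Path fs u→m , λ m→y → least _ (Path⇒reach fs (reach⇒Path fs u→m ▷▷ m→y))

SameClasses : ∀ {n} → Maps n → Maps n → Set
SameClasses fs gs = ∀ {x y} → Path fs x y ⇔ Path gs x y

isRep-cong : ∀ {n} {fs gs : Maps n} → SameClasses fs gs → ∀ x → isRep fs x ≡ isRep gs x
isRep-cong {fs = fs} {gs} same x = bool-ext
  (λ e → IsLeast⇒isRep gs (isRep⇒IsLeast fs e ∘ from same))
  (λ e → IsLeast⇒isRep fs (isRep⇒IsLeast gs e ∘ to same))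

classes : ∀ {n} → Maps n → ℕ
classes fs = ∣ isRep fs ∣

classes-cong : ∀ {n} {fs gs : Maps n} → SameClasses fs gs → classes fs ≡ classes gs
classes-cong same = ∣∣-cong (isRep-cong same)

classes-antimono : ∀ {n} {fs gs : Maps n} → Involutive gs →
                   (∀ {x y} → Path fs x y → Path gs x y) → classes gs ≤ classes fs
classes-antimono {fs = fs} {gs} inv fs⇒gs = ∣∣-injection (λ x m → IsLeast gs x × Path fs x m) image injective
  where
  image : ∀ x → isRep gs x ≡ true → ∃[ m ] isRep fs m ≡ true × (IsLeast gs x × Path fs x m)
  image x e with least-of-class fs x
  ... | m , x→m , m-least = m , IsLeast⇒isRep fs m-least , isRep⇒IsLeast gs e , x→m
  injective : ∀ {x x′ m} → IsLeast gs x × Path fs x m → IsLeast gs x′ × Path fs x′ m → x ≡ x′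
  injective (x-least , x→m) (x′-least , x′→m) =
    IsLeast-unique inv x-least x′-least (fs⇒gs x→m ▷▷ Path-sym inv (fs⇒gs x′→m))

swap : ∀ {n} → Fin n → Fin n → Fin n → Fin n
swap u v z = if z == u then v else if z == v then u else z

swap-u : ∀ {n} (u v : Fin n) → swap u v u ≡ v
swap-u u v rewrite ==-refl u = refl

swap-v : ∀ {n} (u v : Fin n) → swap u v v ≡ u
swap-v u v with v ≟ᶠ u
... | yes v≡u = v≡u
... | no  _   rewrite ==-refl v = refl

swap-elsewhere : ∀ {n} {u v z : Fin n} → z ≢ u → z ≢ v → swap u v z ≡ z
swap-elsewhere z≢u z≢v rewrite ≢⇒==false z≢u | ≢⇒==false z≢v = refl

data SwapView {n} (u v : Fin n) : Fin n → Set where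
  at-u      : SwapView u v u
  at-v      : SwapView u v v
  elsewhere : ∀ {z} → swap u v z ≡ z → SwapView u v z

swap-view : ∀ {n} (u v z : Fin n) → SwapView u v z
swap-view u v z with z ≟ᶠ u | z ≟ᶠ v
... | yes refl | _        = at-u
... | no  _    | yes refl = at-v
... | no  z≢u  | no  z≢v  = elsewhere (swap-elsewhere z≢u z≢v)

swap-involutive : ∀ {n} (u v z : Fin n) → swap u v (swap u v z) ≡ z
swap-involutive u v z with swap-view u v z
... | at-u        rewrite swap-u u v = swap-v u v
... | at-v        rewrite swap-v u v = swap-u u v
... | elsewhere e rewrite e = e

Involutive-∷ : ∀ {n} {h : Fin n → Fin n} {fs : Maps n} →
               (∀ x → h (h x) ≡ x) → Involutive fs → Involutive (h ∷ fs)
Involutive-∷ h-inv inv (here refl) = h-inv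
Involutive-∷ h-inv inv (there f∈fs) = inv f∈fs

Path-∷ : ∀ {n} {h : Fin n → Fin n} {fs : Maps n} {x y} → Path fs x y → Path (h ∷ fs) x y
Path-∷ = Path-map (λ f∈fs _ → edge (there f∈fs))

data Merged {n} (fs : Maps n) (a b x y : Fin n) : Set where
  direct : Path fs x y → Merged fs a b x y
  via-ab : Path fs x a → Path fs b y → Merged fs a b x y
  via-ba : Path fs x b → Path fs a y → Merged fs a b x y

Merged-comm : ∀ {n} {fs : Maps n} {a b x y} → Merged fs a b x y → Merged fs b a x y
Merged-comm (direct p)   = direct p
Merged-comm (via-ab p q) = via-ba p q
Merged-comm (via-ba p q) = via-ab p q

Merged-move : ∀ {n} {fs : Maps n} → Involutive fs → ∀ {a a′ b b′ x y} →
              Path fs a a′ → Path fs b b′ → Merged fs a b x y → Merged fs a′ b′ x y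
Merged-move inv a→a′ b→b′ (direct p)   = direct p
Merged-move inv a→a′ b→b′ (via-ab p q) = via-ab (p ▷▷ a→a′) (Path-sym inv b→b′ ▷▷ q)
Merged-move inv a→a′ b→b′ (via-ba p q) = via-ba (p ▷▷ b→b′) (Path-sym inv a→a′ ▷▷ q)

Merged⇒Path : ∀ {n} {fs : Maps n} {u v x y} → Merged fs u v x y → Path (swap u v ∷ fs) x y
Merged⇒Path (direct p)           = Path-∷ p
Merged⇒Path {u = u} {v} (via-ab p q) = Path-∷ p ▷▷ (subst (Path _ u) (swap-u u v) (edge (here refl)) ▷▷ Path-∷ q)
Merged⇒Path {u = u} {v} (via-ba p q) = Path-∷ p ▷▷ (subst (Path _ v) (swap-v u v) (edge (here refl)) ▷▷ Path-∷ q)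

Path⇒Merged : ∀ {n} {fs : Maps n} {u v x y} → Path (swap u v ∷ fs) x y → Merged fs u v x y
Path⇒Merged [] = direct []
Path⇒Merged (p ▷ there f∈fs) with Path⇒Merged p
... | direct q   = direct (q ▷ f∈fs)
... | via-ab q r = via-ab q (r ▷ f∈fs)
... | via-ba q r = via-ba q (r ▷ f∈fs)
Path⇒Merged {u = u} {v} (_▷_ {y} p (here refl)) with swap-view u v y | Path⇒Merged p
... | at-u | m rewrite swap-u u v = at-v-of m
  where
  at-v-of : Merged _ u v _ u → Merged _ u v _ v
  at-v-of (direct q)   = via-ab q []
  at-v-of (via-ab q _) = via-ab q []
  at-v-of (via-ba q _) = direct q
... | at-v | m rewrite swap-v u v = at-u-of m
  where
  at-u-of : Merged _ u v _ v → Merged _ u v _ u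
  at-u-of (direct q)   = via-ba q []
  at-u-of (via-ab q _) = direct q
  at-u-of (via-ba q _) = via-ba q []
... | elsewhere e | m rewrite e = m

-- Joining the classes of two least vertices lo < hi leaves hi as the only vertex that stops being least.
module _ {n} {fs gs : Maps n} (inv : Involutive fs) {lo hi : Fin n}
         (lo-least : IsLeast fs lo) (hi-least : IsLeast fs hi) (lo<hi : toℕ lo < toℕ hi)
         (merged : ∀ {x y} → Path gs x y ⇔ Merged fs lo hi x y) where

  isRep-merged : ∀ x → isRep gs x ≡ (isRep fs x ∧ not (x == hi))
  isRep-merged x = bool-ext ⇒ ⇐
    where
    ⇒ : isRep gs x ≡ true → (isRep fs x ∧ not (x == hi)) ≡ true
    ⇒ e = ∧-intro (IsLeast⇒isRep fs (x-least ∘ from merged ∘ direct)) (not-false (≢⇒==false x≢hi))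
      where
      x-least = isRep⇒IsLeast gs e
      x≢hi : x ≢ hi
      x≢hi refl = <⇒≱ lo<hi (x-least (from merged (via-ba [] [])))
    ⇐ : (isRep fs x ∧ not (x == hi)) ≡ true → isRep gs x ≡ true
    ⇐ e = IsLeast⇒isRep gs (λ p → least (to merged p))
      where
      x-least = isRep⇒IsLeast fs (∧-elimˡ _ e)
      x≢hi : x ≢ hi
      x≢hi refl = contradiction (trans (sym (==-refl hi)) (not-true (∧-elimʳ (isRep fs hi) e))) true≢false
      least : ∀ {y} → Merged fs lo hi x y → toℕ x ≤ toℕ y
      least (direct p) = x-least p
      least (via-ab x→lo hi→y) with IsLeast-unique inv x-least lo-least x→lo
      ... | refl = ≤-trans (<⇒≤ lo<hi) (hi-least hi→y)
      least (via-ba x→hi _) = contradiction (IsLeast-unique inv x-least hi-least x→hi) x≢hi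

  classes-merged : classes fs ≡ suc (classes gs)
  classes-merged = trans (∣∣-remove (isRep fs) (IsLeast⇒isRep fs hi-least))
                         (cong suc (sym (∣∣-cong isRep-merged)))

δ : Bool → ℕ
δ b = if b then 0 else 1

classes-swap : ∀ {n} {fs : Maps n} → Involutive fs → ∀ u v →
               classes fs ≡ classes (swap u v ∷ fs) + δ (reach fs u v)
classes-swap {fs = fs} inv u v with reach fs u v in connected
... | true  = sym (trans (+-identityʳ _) (classes-cong (mk⇔ (collapse ∘ Path⇒Merged) (Merged⇒Path ∘ direct))))
  where
  u→v = reach⇒Path fs connected
  collapse : ∀ {x y} → Merged fs u v x y → Path fs x y
  collapse (direct p)   = p
  collapse (via-ab p q) = p ▷▷ (u→v ▷▷ q)
  collapse (via-ba p q) = p ▷▷ (Path-sym inv u→v ▷▷ q)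
... | false with least-of-class fs u | least-of-class fs v
... | mu , u→mu , mu-least | mv , v→mv , mv-least with <-cmp (toℕ mu) (toℕ mv)
... | tri< mu<mv _ _ = trans (classes-merged inv mu-least mv-least mu<mv merged) (+-comm 1 _)
  where
  merged : ∀ {x y} → Path (swap u v ∷ fs) x y ⇔ Merged fs mu mv x y
  merged = mk⇔ (Merged-move inv u→mu v→mv ∘ Path⇒Merged)
               (Merged⇒Path ∘ Merged-move inv (Path-sym inv u→mu) (Path-sym inv v→mv))
... | tri> _ _ mv<mu = trans (classes-merged inv mv-least mu-least mv<mu merged) (+-comm 1 _)
  where
  merged : ∀ {x y} → Path (swap u v ∷ fs) x y ⇔ Merged fs mv mu x y
  merged = mk⇔ (Merged-comm ∘ Merged-move inv u→mu v→mv ∘ Path⇒Merged)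
               (Merged⇒Path ∘ Merged-move inv (Path-sym inv u→mu) (Path-sym inv v→mv) ∘ Merged-comm)
... | tri≈ _ mu≡mv _ = contradiction (Path⇒reach fs u→v) (λ e → true≢false (trans (sym e) connected))
  where
  u→v = u→mu ▷▷ subst (λ m → Path fs m v) (sym (toℕ-injective mu≡mv)) (Path-sym inv v→mv)

swaps : ∀ {n} → List (Fin n × Fin n) → Maps n
swaps = map (λ (u , v) → swap u v)

Involutive-swaps-++ : ∀ {n} (L : List (Fin n × Fin n)) {fs : Maps n} → Involutive fs → Involutive (swaps L ++ fs)
Involutive-swaps-++ L inv f∈ with ∈-++⁻ (swaps L) f∈
... | inj₂ f∈fs = inv f∈fs
... | inj₁ f∈L with ∈-map⁻ (λ (u , v) → swap u v) f∈L
...   | (u , v) , _ , refl = swap-involutive u v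

Path-swaps-++ : ∀ {n} (L : List (Fin n × Fin n)) {fs gs : Maps n} → (∀ {x y} → Path fs x y → Path gs x y) →
                ∀ {x y} → Path (swaps L ++ fs) x y → Path (swaps L ++ gs) x y
Path-swaps-++ L {fs} {gs} fs⇒gs = Path-map lift
  where
  lift : ∀ {f} → f ∈ swaps L ++ fs → ∀ z → Path (swaps L ++ gs) z (f z)
  lift f∈ z with ∈-++⁻ (swaps L) f∈
  ... | inj₁ f∈L  = edge (∈-++⁺ˡ f∈L)
  ... | inj₂ f∈fs = Path-map (λ g∈gs _ → edge (∈-++⁺ʳ (swaps L) g∈gs)) (fs⇒gs (edge f∈fs))

δ-antimono : ∀ {a b} → (a ≡ true → b ≡ true) → δ b ≤ δ a
δ-antimono {true}  a⇒b rewrite a⇒b refl = ≤-refl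
δ-antimono {false} {true}  _ = z≤n
δ-antimono {false} {false} _ = ≤-refl

-- A swap merges two classes of the coarser graph only if it merges two classes of the finer one.
classes-swaps-submodular : ∀ {n} {fs gs : Maps n} → Involutive fs → Involutive gs →
  (∀ {x y} → Path fs x y → Path gs x y) → ∀ L →
  classes gs + classes (swaps L ++ fs) ≤ classes fs + classes (swaps L ++ gs)
classes-swaps-submodular {fs = fs} {gs} _ _ _ [] = ≤-reflexive (+-comm (classes gs) (classes fs))
classes-swaps-submodular {fs = fs} {gs} fs-inv gs-inv fs⇒gs ((u , v) ∷ L) =
  +-cancelʳ-≤ (δ (reach fs′ u v)) _ _ (begin
    classes gs + classes (swap u v ∷ fs′) + δ (reach fs′ u v)   ≡⟨ +-assoc (classes gs) _ _ ⟩
    classes gs + (classes (swap u v ∷ fs′) + δ (reach fs′ u v)) ≡⟨ cong (classes gs +_) (classes-swap fs′-inv u v) ⟨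
    classes gs + classes fs′                                    ≤⟨ classes-swaps-submodular fs-inv gs-inv fs⇒gs L ⟩
    classes fs + classes gs′                                    ≡⟨ cong (classes fs +_) (classes-swap gs′-inv u v) ⟩
    classes fs + (classes (swap u v ∷ gs′) + δ (reach gs′ u v)) ≤⟨ +-monoʳ-≤ (classes fs) (+-monoʳ-≤ _ δ≤) ⟩
    classes fs + (classes (swap u v ∷ gs′) + δ (reach fs′ u v)) ≡⟨ +-assoc (classes fs) _ _ ⟨
    classes fs + classes (swap u v ∷ gs′) + δ (reach fs′ u v)   ∎)
  where
  open ≤-Reasoning
  fs′ = swaps L ++ fs
  gs′ = swaps L ++ gs
  fs′-inv = Involutive-swaps-++ L fs-inv
  gs′-inv = Involutive-swaps-++ L gs-inv
  δ≤ : δ (reach gs′ u v) ≤ δ (reach fs′ u v)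
  δ≤ = δ-antimono (Path⇒reach gs′ ∘ Path-swaps-++ L fs⇒gs ∘ reach⇒Path fs′)

SameClasses-swaps : ∀ {n} (h : Fin n → Fin n) → (∀ x → h (h x) ≡ x) → (fs : Maps n) →
              SameClasses (swaps (map (λ x → x , h x) (allFin n)) ++ fs) (h ∷ fs)
SameClasses-swaps {n} h h-inv fs = mk⇔ (Path-map ⇒) (Path-map ⇐)
  where
  pairs = map (λ x → x , h x) (allFin n)
  ⇒ : ∀ {f} → f ∈ swaps pairs ++ fs → ∀ z → Path (h ∷ fs) z (f z)
  ⇒ f∈ z with ∈-++⁻ (swaps pairs) f∈
  ... | inj₂ f∈fs = edge (there f∈fs)
  ... | inj₁ f∈swaps with ∈-map⁻ (λ (u , v) → swap u v) f∈swaps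
  ...   | _ , w∈pairs , refl with ∈-map⁻ (λ x → x , h x) w∈pairs
  ...     | w , _ , refl with swap-view w (h w) z
  ...       | at-u rewrite swap-u w (h w) = edge (here refl)
  ...       | at-v rewrite swap-v w (h w) = subst (Path _ (h w)) (h-inv w) (edge (here refl))
  ...       | elsewhere e rewrite e = []
  ⇐ : ∀ {f} → f ∈ h ∷ fs → ∀ z → Path (swaps pairs ++ fs) z (f z)
  ⇐ (there f∈fs) z = edge (∈-++⁺ʳ (swaps pairs) f∈fs)
  ⇐ (here refl)  z = subst (Path _ z) (swap-u z (h z))
    (edge (∈-++⁺ˡ (∈-map⁺ (λ (u , v) → swap u v) (∈-map⁺ (λ x → x , h x) (∈-allFin z)))))

classes-submodular : ∀ {n} {fs gs : Maps n} {h : Fin n → Fin n} →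
  Involutive fs → Involutive gs → (∀ x → h (h x) ≡ x) → (∀ {x y} → Path fs x y → Path gs x y) →
  classes gs + classes (h ∷ fs) ≤ classes fs + classes (h ∷ gs)
classes-submodular {n} {fs} {gs} {h} fs-inv gs-inv h-inv fs⇒gs =
  subst₂ (λ a b → classes gs + a ≤ classes fs + b)
    (classes-cong (SameClasses-swaps h h-inv fs)) (classes-cong (SameClasses-swaps h h-inv gs))
    (classes-swaps-submodular fs-inv gs-inv fs⇒gs (map (λ x → x , h x) (allFin n)))

classes-exchange : ∀ {n} {fs gs ks : Maps n} {h : Fin n → Fin n} →
  Involutive fs → Involutive gs → (∀ x → h (h x) ≡ x) → (∀ {x y} → Path fs x y → Path gs x y) →
  (∀ {x y} → Path ks x y → Path (h ∷ gs) x y) →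
  classes gs + classes (h ∷ fs) ≤ classes fs + classes ks
classes-exchange fs-inv gs-inv h-inv fs⇒gs ks⇒hgs =
  ≤-trans (classes-submodular fs-inv gs-inv h-inv fs⇒gs)
          (+-monoʳ-≤ _ (classes-antimono (Involutive-∷ h-inv gs-inv) ks⇒hgs))

restrict : ∀ {n} → Pred n → (Fin n → Fin n) → Fin n → Fin n
restrict P f x = if P x then f x else x

restrict-in : ∀ {n} (P : Pred n) f {x} → P x ≡ true → restrict P f x ≡ f x
restrict-in P f e rewrite e = refl

restrict-out : ∀ {n} (P : Pred n) f {x} → P x ≡ false → restrict P f x ≡ x
restrict-out P f e rewrite e = refl

Path-restrict : ∀ {n} (P : Pred n) {f} {fs : Maps n} → f ∈ fs → ∀ z → Path fs z (restrict P f z)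
Path-restrict P {f} f∈fs z with P z
... | true  = edge f∈fs
... | false = []

restrict-involutive : ∀ {n} {P : Pred n} {f} → (∀ x → P (f x) ≡ P x) → (∀ x → f (f x) ≡ x) →
                      ∀ x → restrict P f (restrict P f x) ≡ x
restrict-involutive {P = P} {f} P-f f-inv x with P x in e
... | false rewrite e = refl
... | true  rewrite P-f x | e = f-inv x

module _ {n} (P : Pred n) {fs : Maps n} (P-closed : ∀ {f} → f ∈ fs → ∀ x → P (f x) ≡ P x) where

  private
    fsP = map (restrict P) fs

    Path-outside : ∀ {x y} → P x ≡ false → Path fsP x y → y ≡ x
    Path-outside px [] = refl
    Path-outside px (p ▷ f∈) with ∈-map⁻ (restrict P) f∈ | Path-outside px p
    ... | f , _ , refl | refl = restrict-out P f px

    Path-inside⇒ : ∀ {x y} → P x ≡ true → Path fsP x y → Path fs x y × P y ≡ true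
    Path-inside⇒ px [] = [] , px
    Path-inside⇒ px (_▷_ {z} p f∈) with ∈-map⁻ (restrict P) f∈ | Path-inside⇒ px p
    ... | _ , f∈fs , refl | q , pz rewrite pz = q ▷ f∈fs , trans (P-closed f∈fs z) pz

    Path-inside⇐ : ∀ {x y} → P x ≡ true → Path fs x y → Path fsP x y × P y ≡ true
    Path-inside⇐ px [] = [] , px
    Path-inside⇐ px (_▷_ {z} {f} p f∈fs) with Path-inside⇐ px p
    ... | q , pz = subst (Path fsP _) (restrict-in P f pz) (q ▷ ∈-map⁺ (restrict P) f∈fs) , trans (P-closed f∈fs z) pz

  classes-restrict : classes (map (restrict P) fs) ≡ ∣ (λ x → P x ∧ isRep fs x) ∣ + ∣ not ∘ P ∣
  classes-restrict = trans (∣∣-partition (isRep fsP) P) (cong₂ _+_ (∣∣-cong inside) (∣∣-cong outside))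
    where
    inside : ∀ x → (isRep fsP x ∧ P x) ≡ (P x ∧ isRep fs x)
    inside x with P x in px
    ... | false = ∧-zeroʳ _
    ... | true  = trans (∧-identityʳ _) (bool-ext
      (λ e → IsLeast⇒isRep fs (λ p → isRep⇒IsLeast fsP e (proj₁ (Path-inside⇐ px p))))
      (λ e → IsLeast⇒isRep fsP (λ p → isRep⇒IsLeast fs e (proj₁ (Path-inside⇒ px p)))))
    outside : ∀ x → (isRep fsP x ∧ not (P x)) ≡ not (P x)
    outside x with P x in px
    ... | true  = ∧-zeroʳ _
    ... | false = trans (∧-identityʳ _) (IsLeast⇒isRep fsP (λ p → ≤-reflexive (cong toℕ (sym (Path-outside px p)))))

lower : ∀ {n} → (Fin n → Fin n) → Pred n
lower f x = toℕ x <ᵇ toℕ (f x)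

edges : ∀ {n} → (Fin n → Fin n) → Pred n → ℕ
edges f P = ∣ (λ x → P x ∧ lower f x) ∣

<ᵇ-false : ∀ {m n} → ¬ m < n → (m <ᵇ n) ≡ false
<ᵇ-false {m} {n} m≮n with m <ᵇ n in e
... | false = refl
... | true  = contradiction (<ᵇ⇒< m n (from T-≡ e)) m≮n

not-<ᵇ : ∀ {a b} → a ≢ b → not (a <ᵇ b) ≡ (b <ᵇ a)
not-<ᵇ {a} {b} a≢b with <-cmp a b
... | tri< a<b _ _ rewrite to T-≡ (<⇒<ᵇ a<b) = sym (<ᵇ-false (<⇒≯ a<b))
... | tri≈ _ a≡b _ = contradiction a≡b a≢b
... | tri> _ _ b<a rewrite to T-≡ (<⇒<ᵇ b<a) = cong not (<ᵇ-false (<⇒≯ b<a))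

module _ {n} {f : Fin n → Fin n} (f-inv : ∀ x → f (f x) ≡ x) (f-fpf : ∀ x → f x ≢ x) where

  private
    toℕ-fpf : ∀ x → toℕ x ≢ toℕ (f x)
    toℕ-fpf x e = f-fpf x (sym (toℕ-injective e))

  isRep-matching : ∀ x → isRep (f ∷ []) x ≡ lower f x
  isRep-matching x = bool-ext
    (λ e → to T-≡ (<⇒<ᵇ (≤∧≢⇒< (isRep⇒IsLeast (f ∷ []) e (edge (here refl))) (toℕ-fpf x))))
    (λ e → IsLeast⇒isRep (f ∷ []) (least (<ᵇ⇒< _ _ (from T-≡ e))))
    where
    ends : ∀ {y} → Path (f ∷ []) x y → y ≡ x ⊎ y ≡ f x
    ends [] = inj₁ refl
    ends (p ▷ here refl) with ends p
    ... | inj₁ refl = inj₂ refl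
    ... | inj₂ refl = inj₁ (f-inv x)
    least : toℕ x < toℕ (f x) → IsLeast (f ∷ []) x
    least x<fx p with ends p
    ... | inj₁ refl = ≤-refl
    ... | inj₂ refl = <⇒≤ x<fx

  ∣∣-halves : (P : Pred n) → (∀ x → P (f x) ≡ P x) → ∣ P ∣ ≡ edges f P + edges f P
  ∣∣-halves P P-f = trans (∣∣-partition P (lower f))
    (cong (edges f P +_) (≤-antisym (∣∣-injection Matched upper⇒lower injective)
                                    (∣∣-injection Matched lower⇒upper injective)))
    where
    Matched : Fin n → Fin n → Set
    Matched x y = y ≡ f x
    injective : ∀ {x x′ y} → Matched x y → Matched x′ y → x ≡ x′
    injective {x} {x′} refl fx≡fx′ = trans (sym (f-inv x)) (trans (cong f fx≡fx′) (f-inv x′))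
    upper⇒lower : ∀ x → (P x ∧ not (lower f x)) ≡ true → ∃[ y ] (P y ∧ lower f y) ≡ true × Matched x y
    upper⇒lower x e = f x , ∧-intro (trans (P-f x) (∧-elimˡ (P x) e))
      (subst (λ z → (toℕ (f x) <ᵇ toℕ z) ≡ true) (sym (f-inv x))
        (trans (sym (not-<ᵇ (toℕ-fpf x))) (∧-elimʳ (P x) e))) , refl
    lower⇒upper : ∀ x → (P x ∧ lower f x) ≡ true → ∃[ y ] (P y ∧ not (lower f y)) ≡ true × Matched x y
    lower⇒upper x e = f x , ∧-intro (trans (P-f x) (∧-elimˡ (P x) e))
      (trans (not-<ᵇ (toℕ-fpf (f x)))
        (subst (λ z → (toℕ z <ᵇ toℕ (f x)) ≡ true) (sym (f-inv x)) (∧-elimʳ (P x) e))) , refl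

+-double-injective : ∀ {a b} → a + a ≡ b + b → a ≡ b
+-double-injective {a} {b} e =
  *-cancelˡ-≡ a b 2 (trans (cong (a +_) (+-identityʳ a)) (trans e (cong (b +_) (sym (+-identityʳ b)))))

edges-invariant : ∀ {n} {f f′ : Fin n → Fin n} (P : Pred n) →
  (∀ x → f (f x) ≡ x) → (∀ x → f x ≢ x) → (∀ x → P (f x) ≡ P x) →
  (∀ x → f′ (f′ x) ≡ x) → (∀ x → f′ x ≢ x) → (∀ x → P (f′ x) ≡ P x) →
  edges f P ≡ edges f′ P
edges-invariant P f-inv f-fpf P-f f′-inv f′-fpf P-f′ =
  +-double-injective (trans (sym (∣∣-halves f-inv f-fpf P P-f)) (∣∣-halves f′-inv f′-fpf P P-f′))

avoids : ∀ {n} → Maps n → Pred n → Fin n → Bool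
avoids {n} fs S x = all (λ y → not (reach fs x y) ∨ not (S y)) (allFin n)

avoiders : ∀ {n} → Maps n → Pred n → ℕ
avoiders fs S = ∣ (λ x → isRep fs x ∧ avoids fs S x) ∣

module _ {n} (fs : Maps n) (S : Pred n) where

  avoids⇒ : ∀ {x} → avoids fs S x ≡ true → ∀ {y} → Path fs x y → S y ≡ false
  avoids⇒ e {y} p with all-true⁻ _ e (∈-allFin y)
  ... | h rewrite Path⇒reach fs p = not-true h

  ⇒avoids : ∀ {x} → (∀ {y} → Path fs x y → S y ≡ false) → avoids fs S x ≡ true
  ⇒avoids {x} h = all-true⁺ _ (allFin n) λ {y} _ → lemma y
    where
    lemma : ∀ y → (not (reach fs x y) ∨ not (S y)) ≡ true
    lemma y with reach fs x y in e
    ... | false = refl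
    ... | true  = not-false (h (reach⇒Path fs e))

  meets : ∀ {x} → avoids fs S x ≡ false → ∃[ y ] Path fs x y × S y ≡ true
  meets {x} e with all-false⁻ _ (allFin n) e
  ... | y , _ , h with reach fs x y in r | S y in s
  ... | true | true = y , reach⇒Path fs r , s

-- On S, fsA has the connectivity of fs; the classes of fs meeting S then correspond to the
-- classes of fsA inside S, through their least vertices in S.
module _ {n} {fs : Maps n} (fsA : Maps n) (S : Pred n) (inv : Involutive fs)
         (fwd  : ∀ {x y} → S x ≡ true → Path fsA x y → S y ≡ true × Path fs x y)
         (back : ∀ {x y} → S x ≡ true → S y ≡ true → Path fs x y → Path fsA x y) where

  private
    meeting : ℕ
    meeting = ∣ (λ x → isRep fs x ∧ not (avoids fs S x)) ∣

    LeastInS : Fin n → Set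
    LeastInS x = S x ≡ true × IsLeast fsA x

  meeting≤ncomp : meeting ≤ ncomp fsA S
  meeting≤ncomp = subst (meeting ≤_) (sym (count≡∣∣ {n} (λ x → S x ∧ isRep fsA x)))
    (∣∣-injection (λ m x → IsLeast fs m × Path fs m x) image injective)
    where
    image : ∀ m → (isRep fs m ∧ not (avoids fs S m)) ≡ true →
            ∃[ x ] (S x ∧ isRep fsA x) ≡ true × (IsLeast fs m × Path fs m x)
    image m e with meets fs S (not-true (∧-elimʳ (isRep fs m) e))
    ... | y , m→y , sy with least-such-that (λ z → S z ∧ reach fs m z) (∧-intro sy (Path⇒reach fs m→y))
    ... | x , sx∧m→x , x-least = x , ∧-intro sx (IsLeast⇒isRep fsA x-leastA) , isRep⇒IsLeast fs (∧-elimˡ _ e) , m→x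
      where
      sx = ∧-elimˡ (S x) sx∧m→x
      m→x = reach⇒Path fs (∧-elimʳ (S x) sx∧m→x)
      x-leastA : IsLeast fsA x
      x-leastA p with fwd sx p
      ... | sy′ , x→y′ = x-least _ (∧-intro sy′ (Path⇒reach fs (m→x ▷▷ x→y′)))
    injective : ∀ {m m′ x} → IsLeast fs m × Path fs m x → IsLeast fs m′ × Path fs m′ x → m ≡ m′
    injective (m-least , m→x) (m′-least , m′→x) = IsLeast-unique inv m-least m′-least (m→x ▷▷ Path-sym inv m′→x)

  ncomp≤meeting : ncomp fsA S ≤ meeting
  ncomp≤meeting = subst (_≤ meeting) (sym (count≡∣∣ {n} (λ x → S x ∧ isRep fsA x)))
    (∣∣-injection (λ x m → LeastInS x × Path fs x m) image injective)
    where
    image : ∀ x → (S x ∧ isRep fsA x) ≡ true →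
            ∃[ m ] (isRep fs m ∧ not (avoids fs S m)) ≡ true × (LeastInS x × Path fs x m)
    image x e with least-of-class fs x
    ... | m , x→m , m-least =
      m , ∧-intro (IsLeast⇒isRep fs m-least) (not-false m-meets) , (sx , isRep⇒IsLeast fsA (∧-elimʳ (S x) e)) , x→m
      where
      sx = ∧-elimˡ (S x) e
      m-meets : avoids fs S m ≡ false
      m-meets with avoids fs S m in a
      ... | false = refl
      ... | true  = contradiction (trans (sym sx) (avoids⇒ fs S a (Path-sym inv x→m))) true≢false
    injective : ∀ {x x′ m} → LeastInS x × Path fs x m → LeastInS x′ × Path fs x′ m → x ≡ x′
    injective ((sx , x-least) , x→m) ((sx′ , x′-least) , x′→m) = toℕ-injective (≤-antisym
      (x-least (back sx sx′ (x→m ▷▷ Path-sym inv x′→m))) (x′-least (back sx′ sx (x′→m ▷▷ Path-sym inv x→m))))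

  classes-split : classes fs ≡ ncomp fsA S + avoiders fs S
  classes-split = begin
    ∣ isRep fs ∣                  ≡⟨ ∣∣-partition (isRep fs) (avoids fs S) ⟩
    avoiders fs S + meeting       ≡⟨ +-comm (avoiders fs S) meeting ⟩
    meeting + avoiders fs S       ≡⟨ cong (_+ avoiders fs S) (≤-antisym meeting≤ncomp ncomp≤meeting) ⟩
    ncomp fsA S + avoiders fs S   ∎
    where open ≡-Reasoning

Path-transfer : ∀ {n} {fs gs : Maps n} {S : Pred n} {x} → (∀ {y} → Path fs x y → S y ≡ false) →
  (∀ {f} → f ∈ gs → ∀ z → S z ≡ false → Path fs z (f z)) → ∀ {y} → Path gs x y → Path fs x y
Path-transfer x-avoids gs⇒fs []           = []
Path-transfer x-avoids gs⇒fs (p ▷ f∈gs) = q ▷▷ gs⇒fs f∈gs _ (x-avoids q)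
  where q = Path-transfer x-avoids gs⇒fs p

-- Classes avoiding S only see the edges outside S.
avoiders-cong : ∀ {n} {fs gs : Maps n} (S : Pred n) →
  (∀ {f} → f ∈ gs → ∀ z → S z ≡ false → Path fs z (f z)) →
  (∀ {f} → f ∈ fs → ∀ z → S z ≡ false → Path gs z (f z)) →
  avoiders fs S ≡ avoiders gs S
avoiders-cong {fs = fs} {gs} S gs⇒fs fs⇒gs = ∣∣-cong λ x → bool-ext (one-way {x = x} gs⇒fs) (one-way {x = x} fs⇒gs)
  where
  one-way : ∀ {fs gs x} → (∀ {f} → f ∈ gs → ∀ z → S z ≡ false → Path fs z (f z)) →
            (isRep fs x ∧ avoids fs S x) ≡ true → (isRep gs x ∧ avoids gs S x) ≡ true
  one-way {fs} {gs} {x} gs⇒fs e = ∧-intro (IsLeast⇒isRep gs (x-least ∘ gs-to-fs)) (⇒avoids gs S (x-avoids ∘ gs-to-fs))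
    where
    x-least = isRep⇒IsLeast fs (∧-elimˡ (isRep fs x) e)
    x-avoids = avoids⇒ fs S (∧-elimʳ (isRep fs x) e)
    gs-to-fs : ∀ {y} → Path gs x y → Path fs x y
    gs-to-fs = Path-transfer x-avoids gs⇒fs

nedges-closed : ∀ {n} (f : Fin n → Fin n) (P : Pred n) → (∀ x → P (f x) ≡ P x) →
                nedges f P ≡ edges f P
nedges-closed {n} f P P-f = trans (count≡∣∣ {n} _) (∣∣-cong same)
  where
  same : ∀ x → (P x ∧ P (f x) ∧ lower f x) ≡ (P x ∧ lower f x)
  same x rewrite P-f x with P x
  ... | true  = refl
  ... | false = refl

[a+a]/2≡a : ∀ a → (a + a) ℕ./ 2 ≡ a
[a+a]/2≡a a = trans (cong (ℕ._/ 2) (trans (cong (a +_) (sym (+-identityʳ a))) (*-comm 2 a))) (m*n/n≡m a 2)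

∣∣-union : ∀ {n} {A : Set} (Q : A → Pred n) (W : Pred n) (es : List A) →
           ∣ (λ x → any (λ e → Q e x) es ∧ W x) ∣ ≤ sum (map (λ e → ∣ (λ x → Q e x ∧ W x) ∣) es)
∣∣-union {n} Q W []       = ≤-reflexive (∣false∣≡0 {n})
∣∣-union {n} Q W (e ∷ es) = begin
  ∣ (λ x → (Q e x ∨ any (λ e′ → Q e′ x) es) ∧ W x) ∣             ≡⟨ ∣∣-cong (λ x → ∧-distribʳ-∨ (W x) (Q e x) _) ⟩
  ∣ (λ x → (Q e x ∧ W x) ∨ (any (λ e′ → Q e′ x) es ∧ W x)) ∣     ≤⟨ ∣∣-∨ (λ x → Q e x ∧ W x) _ ⟩
  ∣ (λ x → Q e x ∧ W x) ∣ + ∣ (λ x → any (λ e′ → Q e′ x) es ∧ W x) ∣ ≤⟨ +-monoʳ-≤ _ (∣∣-union Q W es) ⟩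
  ∣ (λ x → Q e x ∧ W x) ∣ + sum (map (λ e′ → ∣ (λ x → Q e′ x ∧ W x) ∣) es) ∎
  where open ≤-Reasoning

sum-map-mono : ∀ {A : Set} {f g : A → ℕ} → (∀ e → f e ≤ g e) → ∀ es → sum (map f es) ≤ sum (map g es)
sum-map-mono f≤g []       = z≤n
sum-map-mono f≤g (e ∷ es) = +-mono-≤ (f≤g e) (sum-map-mono f≤g es)

iter-suc : ∀ {A : Set} (f : A → A) k z → iter (suc k) f z ≡ iter k f (f z)
iter-suc f zero    z = refl
iter-suc f (suc k) z = cong f (iter-suc f k z)

iter-+ : ∀ {A : Set} (f : A → A) a b z → iter (a + b) f z ≡ iter a f (iter b f z)
iter-+ f zero    b z = refl
iter-+ f (suc a) b z = cong f (iter-+ f a b z)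

iter-injective : ∀ {A : Set} (f : A → A) → (∀ {x y} → f x ≡ f y → x ≡ y) →
                 ∀ k {x y} → iter k f x ≡ iter k f y → x ≡ y
iter-injective f f-inj zero    e = e
iter-injective f f-inj (suc k) e = iter-injective f f-inj k (f-inj e)

period : ∀ {n} (f : Fin n → Fin n) → (∀ {x y} → f x ≡ f y → x ≡ y) → ∀ z →
         ∃[ k ] suc k ≤ n × iter (suc k) f z ≡ z
period {n} f f-inj z with pigeonhole (n<1+n n) (λ (i : Fin (suc n)) → iter (toℕ i) f z)
... | i , j , i<j , fⁱz≡fʲz = k , k<n , sym (iter-injective f f-inj (toℕ i) fⁱz≡fᵏ⁺ⁱz)
  where
  k = toℕ j ∸ suc (toℕ i)
  j≡i+k+1 : toℕ j ≡ toℕ i + suc k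
  j≡i+k+1 = sym (trans (+-suc (toℕ i) k) (m+[n∸m]≡n i<j))
  k<n : suc k ≤ n
  k<n = ≤-trans (m≤n+m (suc k) (toℕ i)) (≤-trans (≤-reflexive (sym j≡i+k+1)) (≤-pred (toℕ<n j)))
  fⁱz≡fᵏ⁺ⁱz : iter (toℕ i) f z ≡ iter (toℕ i) f (iter (suc k) f z)
  fⁱz≡fᵏ⁺ⁱz = trans fⁱz≡fʲz (trans (cong (λ m → iter m f z) j≡i+k+1) (iter-+ f (toℕ i) (suc k) z))

module HalfIntegers where
  open import Data.Integer as ℤ using (ℤ; +_)
  open import Data.Integer.Properties using (pos-+; pos-*)
  open import Data.Integer.Solver using () renaming (module +-*-Solver to ℤ-Solver)
  open import Data.Rational as ℚ using (ℚ; _/_; toℚᵘ)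
  open import Data.Rational.Properties using (toℚᵘ-injective; toℚᵘ-fromℚᵘ; toℚᵘ-homo-+; toℚᵘ-homo‿-)
  open import Data.Rational.Unnormalised as ℚᵘ using (mkℚᵘ; *≡*) renaming (_≃_ to _≃ᵘ_)
  open import Data.Rational.Unnormalised.Properties using (+-cong; -‿cong; module ≃-Reasoning)

  toℚᵘ-/ : ∀ a d → toℚᵘ (a / suc d) ≃ᵘ mkℚᵘ a d
  toℚᵘ-/ a d = toℚᵘ-fromℚᵘ (mkℚᵘ a d)

  /1≡/2 : ∀ a → a / 1 ≡ (a ℤ.* + 2) / 2
  /1≡/2 a = toℚᵘ-injective (begin
    toℚᵘ (a / 1)               ≈⟨ toℚᵘ-/ a 0 ⟩
    mkℚᵘ a 0                   ≈⟨ *≡* (solve 1 (λ a → a :* con (+ 2) := a :* con (+ 2) :* con (+ 1)) refl a) ⟩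
    mkℚᵘ (a ℤ.* + 2) 1         ≈⟨ toℚᵘ-/ (a ℤ.* + 2) 1 ⟨
    toℚᵘ ((a ℤ.* + 2) / 2)     ∎)
    where
    open ≃-Reasoning
    open ℤ-Solver

  /2+/2 : ∀ a c → a / 2 ℚ.+ c / 2 ≡ (a ℤ.+ c) / 2
  /2+/2 a c = toℚᵘ-injective (begin
    toℚᵘ (a / 2 ℚ.+ c / 2)           ≈⟨ toℚᵘ-homo-+ (a / 2) (c / 2) ⟩
    toℚᵘ (a / 2) ℚᵘ.+ toℚᵘ (c / 2)   ≈⟨ +-cong (toℚᵘ-/ a 1) (toℚᵘ-/ c 1) ⟩
    mkℚᵘ a 1 ℚᵘ.+ mkℚᵘ c 1           ≈⟨ *≡* (solve 2 (λ a c → (a :* con (+ 2) :+ c :* con (+ 2)) :* con (+ 2) := (a :+ c) :* con (+ 4)) refl a c) ⟩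
    mkℚᵘ (a ℤ.+ c) 1                 ≈⟨ toℚᵘ-/ (a ℤ.+ c) 1 ⟨
    toℚᵘ ((a ℤ.+ c) / 2)             ∎)
    where
    open ≃-Reasoning
    open ℤ-Solver

  -/2 : ∀ c → ℚ.- (c / 2) ≡ (ℤ.- c) / 2
  -/2 c = toℚᵘ-injective (begin
    toℚᵘ (ℚ.- (c / 2))      ≈⟨ toℚᵘ-homo‿- (c / 2) ⟩
    ℚᵘ.- toℚᵘ (c / 2)       ≈⟨ -‿cong (toℚᵘ-/ c 1) ⟩
    mkℚᵘ (ℤ.- c) 1          ≈⟨ toℚᵘ-/ (ℤ.- c) 1 ⟨
    toℚᵘ ((ℤ.- c) / 2)      ∎)
    where open ≃-Reasoning

  -- `Inv.ρ` as a function of the numbers of components, hypervertices, hyperedges, d and hyperfaces.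
  ρ-value : ℕ → ℕ → ℕ → ℕ → ℕ → ℚ
  ρ-value k v e d f = (+ v ℤ.- + k) / 1 ℚ.+ (+ (2 ℕ.* k) ℤ.- + v ℤ.- + e ℤ.+ + d ℤ.- + f) / 2

  ρ-formula : ∀ k v e d f → ρ-value k v e d f ≡ (+ v ℤ.- + e ℤ.+ + d ℤ.- + f) / 2
  ρ-formula k v e d f =
    trans (cong (ℚ._+ γ / 2) (/1≡/2 (+ v ℤ.- + k)))
          (trans (/2+/2 ((+ v ℤ.- + k) ℤ.* + 2) γ) (cong (_/ 2) twice-ρ))
    where
    open ℤ-Solver
    γ = + (2 ℕ.* k) ℤ.- + v ℤ.- + e ℤ.+ + d ℤ.- + f
    twice-ρ : (+ v ℤ.- + k) ℤ.* + 2 ℤ.+ γ ≡ + v ℤ.- + e ℤ.+ + d ℤ.- + f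
    twice-ρ rewrite pos-* 2 k = solve 5 (λ v k e d f → (v :- k) :* con (+ 2) :+ (con (+ 2) :* k :- v :- e :+ d :- f) := v :- e :+ d :- f)
                                        refl (+ v) (+ k) (+ e) (+ d) (+ f)

  half-difference : ∀ P Q {m} → P ℤ.- Q ≡ + m → P / 2 ℚ.- Q / 2 ≡ + m / 2
  half-difference P Q P-Q≡m = trans (cong (P / 2 ℚ.+_) (-/2 Q)) (trans (/2+/2 P (ℤ.- Q)) (cong (_/ 2) P-Q≡m))

  whole-minus-half : ∀ a Q {m} → a ℤ.* + 2 ℤ.- Q ≡ + m → a / 1 ℚ.- Q / 2 ≡ + m / 2
  whole-minus-half a Q 2a-Q≡m = trans (cong (ℚ._- Q / 2) (/1≡/2 a)) (half-difference (a ℤ.* + 2) Q 2a-Q≡m)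

  pos-+₄ : ∀ a b c d → + (a + b + c + d) ≡ + a ℤ.+ + b ℤ.+ + c ℤ.+ + d
  pos-+₄ a b c d = trans (pos-+ (a + b + c) d) (cong (ℤ._+ + d) (trans (pos-+ (a + b) c) (cong (ℤ._+ + c) (pos-+ a b))))

  balance⇒difference : ∀ {v e d f v′ e′ d′ f′ m} → v + d + e′ + f′ ≡ e + f + v′ + d′ + m →
    (+ v ℤ.- + e ℤ.+ + d ℤ.- + f) ℤ.- (+ v′ ℤ.- + e′ ℤ.+ + d′ ℤ.- + f′) ≡ + m
  balance⇒difference {v} {e} {d} {f} {v′} {e′} {d′} {f′} {m} balance = begin
    (+ v ℤ.- + e ℤ.+ + d ℤ.- + f) ℤ.- (+ v′ ℤ.- + e′ ℤ.+ + d′ ℤ.- + f′)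
      ≡⟨ solve 8 (λ v e d f v′ e′ d′ f′ → (v :- e :+ d :- f) :- (v′ :- e′ :+ d′ :- f′) := (v :+ d :+ e′ :+ f′) :- (e :+ f :+ v′ :+ d′))
               refl (+ v) (+ e) (+ d) (+ f) (+ v′) (+ e′) (+ d′) (+ f′) ⟩
    (+ v ℤ.+ + d ℤ.+ + e′ ℤ.+ + f′) ℤ.- (+ e ℤ.+ + f ℤ.+ + v′ ℤ.+ + d′)
      ≡⟨ cong₂ ℤ._-_ (pos-+₄ v d e′ f′) (pos-+₄ e f v′ d′) ⟨
    + (v + d + e′ + f′) ℤ.- + (e + f + v′ + d′)
      ≡⟨ cong (λ x → + x ℤ.- + (e + f + v′ + d′)) balance ⟩
    + (e + f + v′ + d′ + m) ℤ.- + (e + f + v′ + d′)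
      ≡⟨ cong (ℤ._- + (e + f + v′ + d′)) (pos-+ (e + f + v′ + d′) m) ⟩
    + (e + f + v′ + d′) ℤ.+ + m ℤ.- + (e + f + v′ + d′)
      ≡⟨ solve 2 (λ x m → x :+ m :- x := m) refl (+ (e + f + v′ + d′)) (+ m) ⟩
    + m ∎
    where
    open ≡-Reasoning
    open ℤ-Solver

  double-balance⇒difference : ∀ {D C v′ e′ d′ f′ m} → D + D + e′ + f′ ≡ C + C + v′ + d′ + m →
    (+ D ℤ.- + C) ℤ.* + 2 ℤ.- (+ v′ ℤ.- + e′ ℤ.+ + d′ ℤ.- + f′) ≡ + m
  double-balance⇒difference {D} {C} {v′} {e′} {d′} {f′} balance =
    trans (solve 6 (λ D C v e d f → (D :- C) :* con (+ 2) :- (v :- e :+ d :- f) := (D :- C :+ D :- C) :- (v :- e :+ d :- f))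
                 refl (+ D) (+ C) (+ v′) (+ e′) (+ d′) (+ f′))
          (balance⇒difference {D} {C} {D} {C} {v′} {e′} {d′} {f′} balance)
    where open ℤ-Solver

  ρ-difference : ∀ k v e d f k′ v′ e′ d′ f′ {m} → v + d + e′ + f′ ≡ e + f + v′ + d′ + m →
                 ρ-value k v e d f ℚ.- ρ-value k′ v′ e′ d′ f′ ≡ + m / 2
  ρ-difference k v e d f k′ v′ e′ d′ f′ balance =
    trans (cong₂ ℚ._-_ (ρ-formula k v e d f) (ρ-formula k′ v′ e′ d′ f′))
          (half-difference (+ v ℤ.- + e ℤ.+ + d ℤ.- + f) (+ v′ ℤ.- + e′ ℤ.+ + d′ ℤ.- + f′)
                          (balance⇒difference {v} {e} {d} {f} {v′} {e′} {d′} {f′} balance))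

  excess-over-ρ : ∀ D C k′ v′ e′ d′ f′ {m} → D + D + e′ + f′ ≡ C + C + v′ + d′ + m →
                  (+ D ℤ.- + C) / 1 ℚ.- ρ-value k′ v′ e′ d′ f′ ≡ + m / 2
  excess-over-ρ D C k′ v′ e′ d′ f′ balance =
    trans (cong (λ q → (+ D ℤ.- + C) / 1 ℚ.- q) (ρ-formula k′ v′ e′ d′ f′))
          (whole-minus-half (+ D ℤ.- + C) (+ v′ ℤ.- + e′ ℤ.+ + d′ ℤ.- + f′)
                            (double-balance⇒difference {D} {C} {v′} {e′} {d′} {f′} balance))

module Restriction (H : Gehm) (A : Pred (Gehm.n H)) where
  open Gehm H

  S Sᶜ : Pred n
  S  = supp H A
  Sᶜ = not ∘ S

  br gr bg : Maps n
  br = b ∷ r ∷ []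
  gr = g ∷ r ∷ []
  bg = b ∷ g ∷ []

  br-inv : Involutive br
  br-inv = Involutive-∷ b-inv (Involutive-∷ r-inv λ ())

  S-closed : ∀ {f} → f ∈ br → ∀ x → S (f x) ≡ S x
  S-closed f∈br x = any-cong (λ e → cong (A e ∧_) (reach-closed br-inv f∈br e x)) (allFin n)

  S-b : ∀ x → S (b x) ≡ S x
  S-b = S-closed (here refl)

  S-r : ∀ x → S (r x) ≡ S x
  S-r = S-closed (there (here refl))

  Sᶜ-b : ∀ x → Sᶜ (b x) ≡ Sᶜ x
  Sᶜ-b x = cong not (S-b x)

  Sᶜ-r : ∀ x → Sᶜ (r x) ≡ Sᶜ x
  Sᶜ-r x = cong not (S-r x)

  bS rS bSᶜ rSᶜ : Fin n → Fin n
  bS = restrict S b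
  rS = restrict S r
  bSᶜ = restrict Sᶜ b
  rSᶜ = restrict Sᶜ r

  bS-inv : ∀ x → bS (bS x) ≡ x
  bS-inv = restrict-involutive S-b b-inv
  rS-inv : ∀ x → rS (rS x) ≡ x
  rS-inv = restrict-involutive S-r r-inv
  bSᶜ-inv : ∀ x → bSᶜ (bSᶜ x) ≡ x
  bSᶜ-inv = restrict-involutive Sᶜ-b b-inv
  rSᶜ-inv : ∀ x → rSᶜ (rSᶜ x) ≡ x
  rSᶜ-inv = restrict-involutive Sᶜ-r r-inv

  gA′ : Fin n → Fin n
  gA′ = gA H A

  gAr bgA mixed : Maps n
  gAr = gA′ ∷ r ∷ []
  bgA = b ∷ gA′ ∷ []
  mixed = bS ∷ g ∷ rSᶜ ∷ []

  gr-inv : Involutive gr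
  gr-inv = Involutive-∷ g-inv (Involutive-∷ r-inv λ ())

  bg-inv : Involutive bg
  bg-inv = Involutive-∷ b-inv (Involutive-∷ g-inv λ ())

  mixed-inv : Involutive mixed
  mixed-inv = Involutive-∷ bS-inv (Involutive-∷ g-inv (Involutive-∷ rSᶜ-inv λ ()))

  -- gA x is the first vertex of S on the alternating walk g x, next (g x), next (next (g x)), …;
  -- `out s j` is the j-th vertex of this walk from s.
  next : Fin n → Fin n
  next z = g (r z)

  next-injective : ∀ {x y} → next x ≡ next y → x ≡ y
  next-injective {x} {y} e = begin
    x               ≡⟨ r-inv x ⟨
    r (r x)         ≡⟨ cong r (g-inv (r x)) ⟨
    r (g (next x))  ≡⟨ cong (r ∘ g) e ⟩
    r (g (next y))  ≡⟨ cong r (g-inv (r y)) ⟩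
    r (r y)         ≡⟨ r-inv y ⟩
    y               ∎
    where open ≡-Reasoning

  out : Fin n → ℕ → Fin n
  out s j = iter j next (g s)

  walk-lands : ∀ m y j → j < m → S (iter j next y) ≡ true → S (walk H S m y) ≡ true
  walk-lands (suc m) y j j<m e with S y in sy
  ... | true = sy
  walk-lands (suc m) y zero    _         e | false = contradiction (trans (sym e) sy) true≢false
  walk-lands (suc m) y (suc j) (s≤s j<m) e | false =
    walk-lands m (next y) j j<m (trans (cong S (sym (iter-suc next j y))) e)

  walk-first : ∀ m y j → j < m → (∀ i → i < j → S (iter i next y) ≡ false) → S (iter j next y) ≡ true →
               walk H S m y ≡ iter j next y
  walk-first (suc m) y zero    _         _      e rewrite e = refl
  walk-first (suc m) y (suc j) (s≤s j<m) before e rewrite before 0 (s≤s z≤n) =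
    trans (walk-first m (next y) j j<m (λ i i<j → trans (cong S (sym (iter-suc next i y))) (before (suc i) (s≤s i<j)))
                      (trans (cong S (sym (iter-suc next j y))) e))
          (sym (iter-suc next j y))

  -- The walk out of s returns to r s, which lies in S.
  walk-returns : ∀ {s} → S s ≡ true → ∃[ j ] j < n × S (out s j) ≡ true
  walk-returns {s} ss with period next next-injective (r s)
  ... | k , k<n , nextᵏ⁺¹rs≡rs = k , k<n , trans (cong S outₖ≡rs) (trans (S-r s) ss)
    where
    outₖ≡rs : out s k ≡ r s
    outₖ≡rs = trans (cong (λ w → iter k next (g w)) (sym (r-inv s))) (trans (sym (iter-suc next k (r s))) nextᵏ⁺¹rs≡rs)

  gA-S : ∀ {x} → S x ≡ true → S (gA′ x) ≡ true
  gA-S sx with walk-returns sx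
  ... | j , j<n , sj = walk-lands (suc n) _ j (m≤n⇒m≤1+n j<n) sj

  walk-Path : ∀ {fs} → (∀ {y} → S y ≡ false → Path fs y (next y)) → ∀ m {z y} → Path fs z y → Path fs z (walk H S m y)
  walk-Path next-path zero    p = p
  walk-Path next-path (suc m) {y = y} p with S y in sy
  ... | true  = p
  ... | false = walk-Path next-path m (p ▷▷ next-path sy)

  Path-gA : ∀ {fs} → g ∈ fs → (∀ {y} → S y ≡ false → Path fs y (next y)) → ∀ z → Path fs z (gA′ z)
  Path-gA g∈fs next-path z = walk-Path next-path (suc n) (edge g∈fs)

  Path-gr-gA : ∀ z → Path gr z (gA′ z)
  Path-gr-gA = Path-gA (here refl) (λ _ → edge (there (here refl)) ▷ here refl)

  Path-mixed-gA : ∀ z → Path mixed z (gA′ z)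
  Path-mixed-gA = Path-gA (there (here refl)) λ {y} sy →
    subst (Path mixed y) (restrict-in Sᶜ r (not-false sy)) (edge (there (there (here refl)))) ▷ there (here refl)

  -- A path from O along edges that follow the walks can leave O only onto a segment of a walk out
  -- of O running outside S; so it can re-enter S only in O.
  module Segments (O : Fin n → Set) (O⊆S : ∀ {z} → O z → S z ≡ true) (O-gA : ∀ {z} → O z → O (gA′ z)) where

    OnSegment : Fin n → Set
    OnSegment z = ∃[ s ] ∃[ j ] O s × (∀ i → i ≤ j → S (out s i) ≡ false) × (z ≡ out s j ⊎ z ≡ r (out s j))

    Reached : Fin n → Set
    Reached z = O z ⊎ OnSegment z

    OnSegment-Sᶜ : ∀ {z} → OnSegment z → S z ≡ false
    OnSegment-Sᶜ (s , j , _ , outside , inj₁ refl) = outside j ≤-refl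
    OnSegment-Sᶜ (s , j , _ , outside , inj₂ refl) = trans (S-r (out s j)) (outside j ≤-refl)

    OnSegment-r : ∀ {z} → OnSegment z → OnSegment (r z)
    OnSegment-r (s , j , os , outside , inj₁ refl) = s , j , os , outside , inj₂ refl
    OnSegment-r (s , j , os , outside , inj₂ refl) = s , j , os , outside , inj₁ (r-inv (out s j))

    Reached-g : ∀ {z} → Reached z → Reached (g z)
    Reached-g {z} (inj₁ oz) with S (g z) in sgz
    ... | true  = inj₁ (subst O (walk-first (suc n) (g z) 0 (s≤s z≤n) (λ _ ()) sgz) (O-gA oz))
    ... | false = inj₂ (z , 0 , oz , (λ { i z≤n → sgz }) , inj₁ refl)
    Reached-g (inj₂ (s , zero , os , _ , inj₁ refl)) = inj₁ (subst O (sym (g-inv s)) os)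
    Reached-g (inj₂ (s , suc j , os , outside , inj₁ refl)) =
      inj₂ (s , j , os , (λ i i≤j → outside i (m≤n⇒m≤1+n i≤j)) , inj₂ (g-inv (r (out s j))))
    Reached-g (inj₂ (s , j , os , outside , inj₂ refl)) with S (out s (suc j)) in s′
    ... | false = inj₂ (s , suc j , os , outside′ , inj₁ refl)
      where
      outside′ : ∀ i → i ≤ suc j → S (out s i) ≡ false
      outside′ i i≤1+j with m≤n⇒m<n∨m≡n i≤1+j
      ... | inj₁ i<1+j = outside i (≤-pred i<1+j)
      ... | inj₂ refl  = s′
    ... | true with walk-returns (O⊆S os)
    ... | j₀ , j₀<n , sj₀ = inj₁ (subst O gAs≡out (O-gA os))
      where
      j<j₀ : j < j₀
      j<j₀ = ≰⇒> (λ j₀≤j → contradiction (trans (sym sj₀) (outside j₀ j₀≤j)) true≢false)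
      gAs≡out : gA′ s ≡ out s (suc j)
      gAs≡out = walk-first (suc n) (g s) (suc j) (s≤s (≤-trans j<j₀ (<⇒≤ j₀<n))) (λ i i<1+j → outside i (≤-pred i<1+j)) s′

    Path-returns : ∀ {fs} → (∀ {f} → f ∈ fs → ∀ {z} → Reached z → Reached (f z)) →
                   ∀ {x y} → O x → Path fs x y → S y ≡ true → O y
    Path-returns closed ox p sy with Path-invariant Reached closed (inj₁ ox) p
    ... | inj₁ oy  = oy
    ... | inj₂ seg = contradiction (trans (sym sy) (OnSegment-Sᶜ seg)) true≢false

  gAr-S : ∀ {f} → f ∈ gAr → ∀ {z} → S z ≡ true → S (f z) ≡ true
  gAr-S (here refl)         = gA-S
  gAr-S (there (here refl)) {z} sz = trans (S-r z) sz

  bgA-S : ∀ {f} → f ∈ bgA → ∀ {z} → S z ≡ true → S (f z) ≡ true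
  bgA-S (here refl)         {z} sz = trans (S-b z) sz
  bgA-S (there (here refl)) = gA-S

  module _ {x} (sx : S x ≡ true) where

    gAr-fwd : ∀ {y} → Path gAr x y → S y ≡ true × Path gr x y
    gAr-fwd p = Path-invariant _ gAr-S sx p , Path-map gAr⇒gr p
      where
      gAr⇒gr : ∀ {f} → f ∈ gAr → ∀ z → Path gr z (f z)
      gAr⇒gr (here refl)         = Path-gr-gA
      gAr⇒gr (there (here refl)) _ = edge (there (here refl))

    gAr-back : ∀ {y} → S y ≡ true → Path gr x y → Path gAr x y
    gAr-back sy p = Path-returns closed [] p sy
      where
      open Segments (Path gAr x) (λ q → proj₁ (gAr-fwd q)) (λ q → q ▷ here refl)
      closed : ∀ {f} → f ∈ gr → ∀ {z} → Reached z → Reached (f z)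
      closed (here refl)                    = Reached-g
      closed (there (here refl)) (inj₁ q)   = inj₁ (q ▷ there (here refl))
      closed (there (here refl)) (inj₂ seg) = inj₂ (OnSegment-r seg)

    bgA-fwd : ∀ {y} → Path bgA x y → S y ≡ true × Path mixed x y
    bgA-fwd [] = sx , []
    bgA-fwd (_▷_ {z} p (here refl)) with bgA-fwd p
    ... | sz , q = trans (S-b z) sz , subst (Path mixed x) (restrict-in S b sz) (q ▷ here refl)
    bgA-fwd (_▷_ {z} p (there (here refl))) with bgA-fwd p
    ... | sz , q = gA-S sz , q ▷▷ Path-mixed-gA z

    bgA-back : ∀ {y} → S y ≡ true → Path mixed x y → Path bgA x y
    bgA-back sy p = Path-returns closed [] p sy
      where
      open Segments (Path bgA x) (λ q → proj₁ (bgA-fwd q)) (λ q → q ▷ there (here refl))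
      closed : ∀ {f} → f ∈ mixed → ∀ {z} → Reached z → Reached (f z)
      closed (here refl) (inj₁ q) =
        inj₁ (subst (Path bgA x) (sym (restrict-in S b (proj₁ (bgA-fwd q)))) (q ▷ here refl))
      closed (here refl) (inj₂ seg) = inj₂ (subst OnSegment (sym (restrict-out S b (OnSegment-Sᶜ seg))) seg)
      closed (there (here refl)) = Reached-g
      closed (there (there (here refl))) (inj₁ q) =
        inj₁ (subst (Path bgA x) (sym (restrict-out Sᶜ r (cong not (proj₁ (bgA-fwd q))))) q)
      closed (there (there (here refl))) (inj₂ seg) =
        inj₂ (subst OnSegment (sym (restrict-in Sᶜ r (cong not (OnSegment-Sᶜ seg)))) (OnSegment-r seg))

  classes-gr : classes gr ≡ ncomp gAr S + avoiders gr S
  classes-gr = classes-split gAr S gr-inv (λ sx → gAr-fwd sx) (λ sx → gAr-back sx)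

  classes-mixed : classes mixed ≡ ncomp bgA S + avoiders gr S
  classes-mixed = trans (classes-split bgA S mixed-inv (λ sx → bgA-fwd sx) (λ sx → bgA-back sx))
                        (cong (ncomp bgA S +_) (avoiders-cong S gr⇒mixed mixed⇒gr))
    where
    gr⇒mixed : ∀ {f} → f ∈ gr → ∀ z → S z ≡ false → Path mixed z (f z)
    gr⇒mixed (here refl)         z _  = edge (there (here refl))
    gr⇒mixed (there (here refl)) z sz = subst (Path mixed z) (restrict-in Sᶜ r (not-false sz)) (edge (there (there (here refl))))
    mixed⇒gr : ∀ {f} → f ∈ mixed → ∀ z → S z ≡ false → Path gr z (f z)
    mixed⇒gr (here refl)                 z sz = subst (Path gr z) (sym (restrict-out S b sz)) []
    mixed⇒gr (there (here refl))         z _  = edge (here refl)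
    mixed⇒gr (there (there (here refl))) z sz = subst (Path gr z) (sym (restrict-in Sᶜ r (not-false sz))) (edge (there (here refl)))

  -- v, e, d, f of H|A are vA + isoA, eS, dS, fA + isoA; J counts the g,r-cycles avoiding S.
  eS eSᶜ dS dSᶜ vA fA J : ℕ
  eS  = ∣ (λ x → S x ∧ isRep br x) ∣
  eSᶜ = ∣ (λ x → Sᶜ x ∧ isRep br x) ∣
  dS  = edges r S
  dSᶜ = edges r Sᶜ
  vA  = ncomp gAr S
  fA  = ncomp bgA S
  J   = avoiders gr S

  dSᶜ-b : edges b Sᶜ ≡ dSᶜ
  dSᶜ-b = edges-invariant Sᶜ b-inv b-fpf Sᶜ-b r-inv r-fpf Sᶜ-r

  classes-bSrS : classes (bS ∷ rS ∷ []) ≡ eS + ∣ Sᶜ ∣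
  classes-bSrS = classes-restrict S {br} S-closed

  classes-rS : classes (rS ∷ []) ≡ dS + ∣ Sᶜ ∣
  classes-rS = trans (classes-restrict S {r ∷ []} (λ { (here refl) → S-r }))
                     (cong (_+ ∣ Sᶜ ∣) (∣∣-cong (λ x → cong (S x ∧_) (isRep-matching r-inv r-fpf x))))

  classes-rSᶜbSᶜ : classes (rSᶜ ∷ bSᶜ ∷ []) ≡ eSᶜ + ∣ S ∣
  classes-rSᶜbSᶜ = trans (classes-restrict Sᶜ {r ∷ b ∷ []} (λ { (here refl) → Sᶜ-r ; (there (here refl)) → Sᶜ-b }))
    (cong₂ _+_ (∣∣-cong (λ x → cong (Sᶜ x ∧_) (isRep-cong rb≈br x))) (∣∣-cong (λ x → not-involutive (S x))))
    where
    rb≈br : SameClasses (r ∷ b ∷ []) br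
    rb≈br = mk⇔ (Path-map λ { (here refl) _ → edge (there (here refl)) ; (there (here refl)) _ → edge (here refl) })
                (Path-map λ { (here refl) _ → edge (there (here refl)) ; (there (here refl)) _ → edge (here refl) })

  classes-bSᶜ : classes (bSᶜ ∷ []) ≡ dSᶜ + ∣ S ∣
  classes-bSᶜ = trans (classes-restrict Sᶜ {b ∷ []} (λ { (here refl) → Sᶜ-b }))
    (cong₂ _+_ (trans (∣∣-cong (λ x → cong (Sᶜ x ∧_) (isRep-matching b-inv b-fpf x))) dSᶜ-b)
               (∣∣-cong (λ x → not-involutive (S x))))

  x-inequality : classes bg + eSᶜ ≤ dSᶜ + (fA + J)
  x-inequality = +-cancelʳ-≤ ∣ S ∣ _ _ (begin
    classes bg + eSᶜ + ∣ S ∣                 ≡⟨ +-assoc (classes bg) eSᶜ ∣ S ∣ ⟩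
    classes bg + (eSᶜ + ∣ S ∣)               ≡⟨ cong (classes bg +_) classes-rSᶜbSᶜ ⟨
    classes bg + classes (rSᶜ ∷ bSᶜ ∷ [])    ≤⟨ classes-exchange (Involutive-∷ bSᶜ-inv λ ()) bg-inv rSᶜ-inv
                                                                (Path-map bSᶜ⇒bg) (Path-map mixed⇒rSᶜbg) ⟩
    classes (bSᶜ ∷ []) + classes mixed       ≡⟨ cong₂ _+_ classes-bSᶜ classes-mixed ⟩
    dSᶜ + ∣ S ∣ + (fA + J)                   ≡⟨ solve 4 (λ d s f j → d :+ s :+ (f :+ j) := d :+ (f :+ j) :+ s) refl dSᶜ ∣ S ∣ fA J ⟩
    dSᶜ + (fA + J) + ∣ S ∣                   ∎)
    where
    open ≤-Reasoning
    open +-*-Solver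
    bSᶜ⇒bg : ∀ {f} → f ∈ bSᶜ ∷ [] → ∀ z → Path bg z (f z)
    bSᶜ⇒bg (here refl) = Path-restrict Sᶜ (here refl)
    mixed⇒rSᶜbg : ∀ {f} → f ∈ mixed → ∀ z → Path (rSᶜ ∷ bg) z (f z)
    mixed⇒rSᶜbg (here refl)                 = Path-restrict S (there (here refl))
    mixed⇒rSᶜbg (there (here refl))         _ = edge (there (there (here refl)))
    mixed⇒rSᶜbg (there (there (here refl))) _ = edge (here refl)

  v+e≤d+f : vA + eS ≤ dS + fA
  v+e≤d+f = +-cancelʳ-≤ (J + ∣ Sᶜ ∣) _ _ (begin
    vA + eS + (J + ∣ Sᶜ ∣)                 ≡⟨ solve 4 (λ v e j c → v :+ e :+ (j :+ c) := v :+ j :+ (e :+ c)) refl vA eS J ∣ Sᶜ ∣ ⟩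
    vA + J + (eS + ∣ Sᶜ ∣)                 ≡⟨ cong₂ _+_ classes-gr classes-bSrS ⟨
    classes gr + classes (bS ∷ rS ∷ [])    ≤⟨ classes-exchange (Involutive-∷ rS-inv λ ()) gr-inv bS-inv
                                                              (Path-map rS⇒gr) (Path-map mixed⇒bSgr) ⟩
    classes (rS ∷ []) + classes mixed      ≡⟨ cong₂ _+_ classes-rS classes-mixed ⟩
    dS + ∣ Sᶜ ∣ + (fA + J)                 ≡⟨ solve 4 (λ d c f j → d :+ c :+ (f :+ j) := d :+ f :+ (j :+ c)) refl dS ∣ Sᶜ ∣ fA J ⟩
    dS + fA + (J + ∣ Sᶜ ∣)                 ∎)
    where
    open ≤-Reasoning
    open +-*-Solver
    rS⇒gr : ∀ {f} → f ∈ rS ∷ [] → ∀ z → Path gr z (f z)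
    rS⇒gr (here refl) = Path-restrict S (there (here refl))
    mixed⇒bSgr : ∀ {f} → f ∈ mixed → ∀ z → Path (bS ∷ gr) z (f z)
    mixed⇒bSgr (here refl)                 _ = edge (here refl)
    mixed⇒bSgr (there (here refl))         _ = edge (there (here refl))
    mixed⇒bSgr (there (there (here refl))) = Path-restrict Sᶜ (there (there (here refl)))

  half-edges : (P : Pred n) → (∀ x → P (b x) ≡ P x) → (∀ x → P (r x) ≡ P x) →
               (nedges b P + nedges r P) ℕ./ 2 ≡ edges r P
  half-edges P P-b P-r = begin
    (nedges b P + nedges r P) ℕ./ 2  ≡⟨ cong₂ (λ x y → (x + y) ℕ./ 2) b-edges (nedges-closed r P P-r) ⟩
    (edges r P + edges r P) ℕ./ 2    ≡⟨ [a+a]/2≡a (edges r P) ⟩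
    edges r P                        ∎
    where
    open ≡-Reasoning
    b-edges = trans (nedges-closed b P P-b) (edges-invariant P b-inv b-fpf P-b r-inv r-fpf P-r)

  d-supp≤dSet : dS ≤ dSet H A
  d-supp≤dSet = ≤-trans (∣∣-union (λ e x → A e ∧ reach br e x) (lower r) (allFin n))
                        (sum-map-mono hyperedge (allFin n))
    where
    hyperedge : ∀ e → ∣ (λ x → (A e ∧ reach br e x) ∧ lower r x) ∣ ≤ (if A e then dEdge H e else 0)
    hyperedge e with A e
    ... | false = ≤-reflexive (∣false∣≡0 {n})
    ... | true  = ≤-reflexive (sym (half-edges (reach br e) (reach-closed br-inv (here refl) e)
                                                           (reach-closed br-inv (there (here refl)) e)))

  card≤eS : IsEdgeSet H A → card H A ≤ eS
  card≤eS A⊆E = subst (_≤ eS) (sym (count≡∣∣ A)) (∣∣-mono λ x ax →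
    ∧-intro (any-true⁺ _ (∈-allFin x) (∧-intro ax (Path⇒reach br []))) (A⊆E x ax))

  module InvH = Inv H (λ _ → true) g iso
  module InvA = Inv H S gA′ (isoA H A)

  vH≡ : InvH.vv ≡ vA + J + iso
  vH≡ = cong (_+ iso) (trans (count≡∣∣ (isRep gr)) classes-gr)

  eH≡ : InvH.ee ≡ eS + eSᶜ
  eH≡ = trans (count≡∣∣ (isRep br)) (trans (∣∣-partition (isRep br) S)
          (cong₂ _+_ (∣∣-cong (λ x → ∧-comm (isRep br x) (S x))) (∣∣-cong (λ x → ∧-comm (isRep br x) (Sᶜ x)))))

  dH≡ : InvH.dd ≡ dS + dSᶜ
  dH≡ = trans (half-edges (λ _ → true) (λ _ → refl) (λ _ → refl)) (trans (∣∣-partition (lower r) S)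
          (cong₂ _+_ (∣∣-cong (λ x → ∧-comm (lower r x) (S x))) (∣∣-cong (λ x → ∧-comm (lower r x) (Sᶜ x)))))

  fH≡ : InvH.ff ≡ classes bg + iso
  fH≡ = cong (_+ iso) (count≡∣∣ (isRep bg))

  eA≡ : InvA.ee ≡ eS
  eA≡ = count≡∣∣ {n} (λ x → S x ∧ isRep br x)

  dA≡ : InvA.dd ≡ dS
  dA≡ = half-edges S S-b S-r

  x-balance : ∃[ m ] InvH.vv + InvH.dd + InvA.ee + InvA.ff ≡ InvH.ee + InvH.ff + InvA.vv + InvA.dd + m
  x-balance = m , (begin
    InvH.vv + InvH.dd + InvA.ee + InvA.ff
      ≡⟨ cong (_+ InvA.ff) (cong₂ _+_ (cong₂ _+_ vH≡ dH≡) eA≡) ⟩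
    vA + J + iso + (dS + dSᶜ) + eS + (fA + i)
      ≡⟨ solve 8 (λ v j i′ s c e f a → v :+ j :+ i′ :+ (s :+ c) :+ e :+ (f :+ a) := v :+ i′ :+ s :+ e :+ a :+ (c :+ (f :+ j)))
               refl vA J iso dS dSᶜ eS fA i ⟩
    vA + iso + dS + eS + i + (dSᶜ + (fA + J))
      ≡⟨ cong (vA + iso + dS + eS + i +_) slack ⟨
    vA + iso + dS + eS + i + (classes bg + eSᶜ + m)
      ≡⟨ solve 8 (λ v i′ s e a b c m → v :+ i′ :+ s :+ e :+ a :+ (b :+ c :+ m) := e :+ c :+ (b :+ i′) :+ (v :+ a) :+ s :+ m)
               refl vA iso dS eS i (classes bg) eSᶜ m ⟩
    eS + eSᶜ + (classes bg + iso) + (vA + i) + dS + m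
      ≡⟨ cong (_+ m) (cong₂ _+_ (cong (_+ InvA.vv) (cong₂ _+_ eH≡ fH≡)) dA≡) ⟨
    InvH.ee + InvH.ff + InvA.vv + InvA.dd + m ∎)
    where
    i = isoA H A
    m = dSᶜ + (fA + J) ∸ (classes bg + eSᶜ)
    slack : classes bg + eSᶜ + m ≡ dSᶜ + (fA + J)
    slack = m+[n∸m]≡n x-inequality
    open ≡-Reasoning
    open +-*-Solver

  module _ (A⊆E : IsEdgeSet H A) where

    D C : ℕ
    D = dSet H A
    C = card H A

    y-inequality : C + C + vA + dS ≤ D + D + eS + fA
    y-inequality = begin
      C + C + vA + dS     ≡⟨ solve 3 (λ c v d → c :+ c :+ v :+ d := c :+ (v :+ c) :+ d) refl C vA dS ⟩
      C + (vA + C) + dS   ≤⟨ +-monoˡ-≤ dS (+-mono-≤ (card≤eS A⊆E) (+-monoʳ-≤ vA (card≤eS A⊆E))) ⟩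
      eS + (vA + eS) + dS ≤⟨ +-monoˡ-≤ dS (+-monoʳ-≤ eS v+e≤d+f) ⟩
      eS + (dS + fA) + dS ≤⟨ +-mono-≤ (+-monoʳ-≤ eS (+-monoˡ-≤ fA d-supp≤dSet)) d-supp≤dSet ⟩
      eS + (D + fA) + D   ≡⟨ solve 3 (λ e d f → e :+ (d :+ f) :+ d := d :+ d :+ e :+ f) refl eS D fA ⟩
      D + D + eS + fA     ∎
      where
      open ≤-Reasoning
      open +-*-Solver

    y-balance : ∃[ m ] D + D + InvA.ee + InvA.ff ≡ C + C + InvA.vv + InvA.dd + m
    y-balance = m , (begin
      D + D + InvA.ee + InvA.ff   ≡⟨ cong (λ e → D + D + e + InvA.ff) eA≡ ⟩
      D + D + eS + (fA + i)       ≡⟨ solve 4 (λ d e f a → d :+ d :+ e :+ (f :+ a) := d :+ d :+ e :+ f :+ a) refl D eS fA i ⟩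
      D + D + eS + fA + i         ≡⟨ cong (_+ i) slack ⟨
      C + C + vA + dS + m + i     ≡⟨ solve 5 (λ c v d m a → c :+ c :+ v :+ d :+ m :+ a := c :+ c :+ (v :+ a) :+ d :+ m) refl C vA dS m i ⟩
      C + C + (vA + i) + dS + m   ≡⟨ cong (λ d → C + C + InvA.vv + d + m) dA≡ ⟨
      C + C + InvA.vv + InvA.dd + m ∎)
      where
      i = isoA H A
      m = D + D + eS + fA ∸ (C + C + vA + dS)
      slack : C + C + vA + dS + m ≡ D + D + eS + fA
      slack = m+[n∸m]≡n y-inequality
      open ≡-Reasoning
      open +-*-Solver

proposition2 : (H : Gehm) (A : Pred (Gehm.n H)) → IsEdgeSet H A →
    NonNegHalfInt (xExp H A) × NonNegHalfInt (yExp H A)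
proposition2 H A A⊆E =
    (proj₁ x-balance , ρ-difference InvH.kk InvH.vv InvH.ee InvH.dd InvH.ff
                                    InvA.kk InvA.vv InvA.ee InvA.dd InvA.ff (proj₂ x-balance))
  , (proj₁ (y-balance A⊆E) , excess-over-ρ (dSet H A) (card H A) InvA.kk InvA.vv InvA.ee InvA.dd InvA.ff
                                           (proj₂ (y-balance A⊆E)))
  where
  open Restriction H A
  open HalfIntegers
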